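{- Let $G=(V,E)$ be a graph with $n$ vertices that has a perfect matching, let $w\in\mathbb{R}^E$, and let $x=\mathrm{avg}(\mathrm{PM}(G,w))$. Let $W$ be an even walk in $G$ such that $x_e>0$ for every edge $e$ of $W$, and such that $\langle w,\chi_W\rangle<0$. Let $K(n)\le n^n$ denote the number of perfect matchings of the complete graph $K_n$, and let $y=x+\epsilon\chi_W$ for some $0<\epsilon<1/(2nK(n))$. Then: (1) for every vertex $v$, $y(\delta(v))=1$; (2) for every $S\subset V$ with $|S|$ odd, if $x(\delta(S))>1$ then $y(\delta(S))\ge1$; (3) for every edge $e\in E$, $y_e\ge0$.
   Context: $\mathrm{avg}(\mathrm{PM}(G,w))\in\mathbb{R}^E$ is the average of the indicator vectors $\mathbf{1}_M$ over all perfect matchings $M$ of $G$ minimizing $\sum_{e\in M}w_e$. $\delta(S)$ is the set of edges with exactly one endpoint in $S$, $\delta(v)=\delta(\{v\})$, and $z(F)=\sum_{e\in F}z_e$ for $z\in\mathbb{R}^E$. An even walk is either a simple even cycle, or: two edge-disjoint odd cycles $C_1,C_2$ and a path $P$ (edge-disjoint from them, possibly empty) joining $v_1\in C_1$ to $v_2\in C_2$, traversed as $C_1$ from $v_1$, then $P$ to $v_2$, then $C_2$, then $P$ back to $v_1$. Writing the walk as its list of traversed edges $W=(e_1,\dots,e_k)$ ($k$ even; edges of $P$ appear twice), the alternating vector is $\chi_W=\sum_{i=1}^k(-1)^i\mathbf{1}_{e_i}\in\mathbb{R}^E$.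
   Formalization: The weight vector w and the number ε are taken rational instead of real. -}

module Defs where

open import Data.Nat as ℕ using (ℕ; zero; suc; _≡ᵇ_)
open import Data.Nat.Divisibility using (_∣_)
open import Data.Integer as ℤ using (ℤ)
open import Data.Rational as ℚ using (ℚ; 0ℚ; 1ℚ; _≤ᵇ_)
open import Data.Fin as Fin using (Fin; _≟_; _<?_)
open import Data.Fin.Subset as Sub using (Subset; _∈_; ⁅_⁆; inside; outside)
import Data.Fin.Subset.Properties as SubP
open import Data.Vec as Vec using (Vec; []; _∷_)
open import Data.List as List using (List; []; _∷_; _++_; length; filter; allFin; concatMap; map; reverse; [_])
open import Data.List.Relation.Unary.Unique.Propositional using (Unique)
open import Data.List.Relation.Binary.Disjoint.Propositional using (Disjoint)
open import Data.Bool using (Bool; true; false; T; _∧_; _∨_; _xor_; if_then_else_; not)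
open import Data.Bool.Properties using (T?)
open import Data.Sum using (_⊎_)
open import Relation.Nullary using (¬_)
open import Data.Product using (_×_; _,_; proj₁; proj₂; Σ; ∃)
open import Relation.Binary.PropositionalEquality using (_≡_; _≢_)
open import Relation.Nullary.Decidable using (⌊_⌋)

Σℚ : ∀ {m} → (Fin m → ℚ) → ℚ
Σℚ {zero}  f = 0ℚ
Σℚ {suc m} f = f Fin.zero ℚ.+ Σℚ (λ i → f (Fin.suc i))

countℕ : ∀ {m} → (Fin m → Bool) → ℕ
countℕ {zero}  p = 0
countℕ {suc m} p = (if p Fin.zero then 1 else 0) ℕ.+ countℕ (λ i → p (Fin.suc i))

record RawGraph (n : ℕ) : Set where
  field
    m    : ℕ
    ends : Fin m → Fin n × Fin n
open RawGraph public

record Graph (n : ℕ) : Set where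
  field
    raw      : RawGraph n
    loopless : ∀ e → proj₁ (ends raw e) ≢ proj₂ (ends raw e)
    simple   : ∀ e f → (ends raw e ≡ ends raw f) ⊎ (ends raw e ≡ (proj₂ (ends raw f) , proj₁ (ends raw f))) → e ≡ f
open Graph public

-- vectors in ℝ^E (here ℚ^E), edge sets as subsets of E
EVec : ∀ {n} → RawGraph n → Set
EVec G = Fin (m G) → ℚ

ESet : ∀ {n} → RawGraph n → Set
ESet G = Subset (m G)

setSum : ∀ {n} (G : RawGraph n) → EVec G → ESet G → ℚ
setSum G z F = Σℚ (λ e → if ⌊ SubP._∈?_ e F ⌋ then z e else 0ℚ)

δ : ∀ {n} (G : RawGraph n) → Subset n → ESet G
δ G S = Vec.tabulate (λ e →
  if ⌊ SubP._∈?_ (proj₁ (ends G e)) S ⌋ xor ⌊ SubP._∈?_ (proj₂ (ends G e)) S ⌋ then inside else outside)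

δv : ∀ {n} (G : RawGraph n) → Fin n → ESet G
δv G v = δ G ⁅ v ⁆

inner : ∀ {n} (G : RawGraph n) → EVec G → EVec G → ℚ
inner G w z = Σℚ (λ e → w e ℚ.* z e)

allB : ∀ {A : Set} → (A → Bool) → List A → Bool
allB p []       = true
allB p (x ∷ xs) = p x ∧ allB p xs

allSubsets : ∀ k → List (Subset k)
allSubsets zero    = [] ∷ []
allSubsets (suc k) = map (inside ∷_) (allSubsets k) ++ map (outside ∷_) (allSubsets k)

incident : ∀ {n} (G : RawGraph n) → Fin (m G) → Fin n → Bool
incident G e v = ⌊ proj₁ (ends G e) ≟ v ⌋ ∨ ⌊ proj₂ (ends G e) ≟ v ⌋

degIn : ∀ {n} (G : RawGraph n) → ESet G → Fin n → ℕ
degIn G M v = countℕ (λ e → ⌊ SubP._∈?_ e M ⌋ ∧ incident G e v)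

isPM : ∀ {n} (G : RawGraph n) → ESet G → Bool
isPM {n} G M = allB (λ v → degIn G M v ≡ᵇ 1) (allFin n)

perfectMatchings : ∀ {n} (G : RawGraph n) → List (ESet G)
perfectMatchings G = filter (λ M → T? (isPM G M)) (allSubsets (m G))

HasPerfectMatching : ∀ {n} → RawGraph n → Set
HasPerfectMatching G = Σ (ESet G) (λ M → T (isPM G M))

weight : ∀ {n} (G : RawGraph n) → EVec G → ESet G → ℚ
weight G w M = setSum G w M

PM : ∀ {n} (G : RawGraph n) → EVec G → List (ESet G)
PM G w = filter (λ M → T? (allB (λ M' → weight G w M ≤ᵇ weight G w M') (perfectMatchings G)))
                (perfectMatchings G)

-- average of the indicator vectors of a list of edge sets (0 for the empty list)
avg : ∀ {n} (G : RawGraph n) → List (ESet G) → EVec G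
avg G L e with length L
... | zero  = 0ℚ
... | suc k = ℤ.+ (List.length (filter (λ M → SubP._∈?_ e M) L)) ℚ./ suc k

completePairs : ∀ n → List (Fin n × Fin n)
completePairs n = concatMap (λ i → map (i ,_) (filter (i <?_) (allFin n))) (allFin n)

complete : ∀ n → RawGraph n
complete n = record { m = length (completePairs n) ; ends = List.lookup (completePairs n) }

K : ℕ → ℕ
K n = length (perfectMatchings (complete n))

Joins : ∀ {n} (G : RawGraph n) → Fin (m G) → Fin n → Fin n → Set
Joins G e u v = (ends G e ≡ (u , v)) ⊎ (ends G e ≡ (v , u))

data Walk {n} (G : RawGraph n) : List (Fin n) → List (Fin (m G)) → Set where
  stop : ∀ v → Walk G (v ∷ []) []
  step : ∀ {u v vs es} e → Joins G e u v → Walk G (v ∷ vs) es → Walk G (u ∷ v ∷ vs) (e ∷ es)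

Path : ∀ {n} (G : RawGraph n) → Fin n → Fin n → List (Fin (m G)) → Set
Path G a b es = (∃ λ vs → Walk G (a ∷ vs ++ [ b ]) es × Unique (a ∷ vs ++ [ b ]))
              ⊎ (a ≡ b × es ≡ [])

Cycle : ∀ {n} (G : RawGraph n) → Fin n → List (Fin (m G)) → Set
Cycle G v es = ∃ λ vs → Walk G (v ∷ vs ++ [ v ]) es × Unique (v ∷ vs) × 3 ℕ.≤ length es

EvenLen OddLen : ∀ {A : Set} → List A → Set
EvenLen xs = 2 ∣ length xs
OddLen  xs = ¬ (2 ∣ length xs)

data EvenWalk {n} (G : RawGraph n) : List (Fin (m G)) → Set where
  evenCycle : ∀ {v C} → Cycle G v C → EvenLen C → EvenWalk G C
  dumbbell  : ∀ {v₁ v₂ C₁ C₂ P} →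
              Cycle G v₁ C₁ → OddLen C₁ →
              Cycle G v₂ C₂ → OddLen C₂ →
              Path G v₁ v₂ P →
              Disjoint C₁ C₂ → Disjoint P C₁ → Disjoint P C₂ →
              EvenWalk G (C₁ ++ P ++ C₂ ++ reverse P)

-- alternating vector χ_W = Σ_i (-1)^i 1_{e_i}  (i starting at 1)
χ : ∀ {n} (G : RawGraph n) → List (Fin (m G)) → EVec G
χ G []       e = 0ℚ
χ G (f ∷ fs) e = ℚ.- (if ⌊ f ≟ e ⌋ then 1ℚ else 0ℚ) ℚ.- χ G fs e

-- Let N = |PM(G,w)|. As N·x_e is the number of these matchings containing e, N·x(F) is the integer
-- Σ_M |M ∩ F| for every edge set F. A perfect matching meets δ(v) once, and meets δ(S) an odd number of
-- times when |S| is odd, so x(δ(v)) = 1, x(δ(S)) > 1 forces N·x(δ(S)) ≥ N + 2, and x_e > 0 forces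
-- N·x_e ≥ 1. An even walk is a closed walk of even length, so χ_W(δ(v)) = 0; moreover
-- |χ_W(δ(S))| ≤ |W| ≤ 4n, and |χ_W(e)| ≤ 2n because an edge lies on at most one of C₁, P, C₂ and P is
-- traversed twice. Finally N ≤ K(n): sending each edge to its pair of ends maps the perfect matchings of
-- the simple graph G injectively to those of K_n. With ε·2n·K(n) < 1 the perturbation ε·χ_W is then too
-- small to close any of the integral gaps.
module Submission where

open import Defs
open import Data.Nat using (ℕ; _*_)
open import Data.Nat.Divisibility using (_∣_)
open import Data.Integer using (+_)
open import Data.Rational using (ℚ; 0ℚ; 1ℚ; _<_; _≤_; _/_; _+_) renaming (_*_ to _*ℚ_)
open import Data.Fin using (Fin)
open import Data.Fin.Subset using (Subset; ∣_∣)
open import Data.List using (List)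
open import Data.List.Membership.Propositional using (_∈_)
open import Data.Product using (_×_)
open import Relation.Nullary using (¬_)
open import Relation.Binary.PropositionalEquality using (_≡_)

open import Algebra.Bundles using (Semiring; Ring)
open import Algebra.Properties.Group using (⁻¹-involutive)
import Algebra.Properties.Semiring.Sum as SemiringSum
open import Data.Bool as Bool using (Bool; true; false; T; if_then_else_; _∧_; _∨_; _xor_)
import Data.Bool.ListAction as Bool
import Data.Bool.Properties as Bool
open import Data.Bool.Properties using (T?)
open import Data.Empty using (⊥-elim)
open import Data.Fin as Fin using () renaming (zero to fzero; suc to fsuc)
import Data.Fin.Properties as Fin
import Data.Fin.Subset as Subset
import Data.Fin.Subset.Properties as Subset
open import Data.Integer as ℤ using ()
import Data.Integer.Properties as ℤ
import Data.List as List
import Data.List.Properties as List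
open import Data.List.Membership.Propositional using (lose)
open import Data.List.Membership.Propositional.Properties
  using (∈-lookup; ∈-allFin; ∈-map⁺; ∈-map⁻; ∈-++⁺ˡ; ∈-++⁺ʳ; ∈-filter⁺; ∈-filter⁻; ∈-concatMap⁺; ∈-length)
import Data.List.Membership.Setoid.Properties as Membership
open import Data.List.Relation.Binary.Disjoint.Propositional using (Disjoint)
open import Data.List.Relation.Binary.Subset.Propositional using (_⊆_)
import Data.List.Relation.Unary.All as All
import Data.List.Relation.Unary.All.Properties as All
import Data.List.Relation.Unary.AllPairs as AllPairs
open import Data.List.Relation.Unary.AllPairs using (_∷_)
open import Data.List.Relation.Unary.Any as Any using (here; there)
import Data.List.Relation.Unary.Any.Properties as Any
open import Data.List.Relation.Unary.Unique.Propositional using (Unique)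
import Data.List.Relation.Unary.Unique.Propositional.Properties as Unique
open import Data.Nat as ℕ using (zero; suc)
import Data.Nat.DivMod as ℕ
import Data.Nat.Divisibility as ℕ
import Data.Nat.ListAction as ℕ
import Data.Nat.Properties as ℕ
open import Data.Product as Product using (_,_; proj₁; proj₂; ∃)
open import Data.Rational as ℚ using (_-_; -_; fromℚᵘ)
import Data.Rational.Properties as ℚ
open import Data.Rational.Solver using (module +-*-Solver)
open +-*-Solver using (solve; _:=_; con; _:+_; _:*_; _:-_; :-_)
open import Data.Rational.Unnormalised as ℚᵘ using (ℚᵘ; mkℚᵘ)
import Data.Rational.Unnormalised.Properties as ℚᵘ
open import Data.Sum as Sum using (_⊎_; inj₁; inj₂)
open import Data.Unit using (tt)
import Data.Vec as Vec
import Data.Vec.Properties as Vec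
open import Function using (_∘_; id)
open import Function.Bundles using (Equivalence)
open import Relation.Binary.Bundles using (DecTotalOrder)
open import Relation.Binary.PropositionalEquality
  using (_≢_; refl; sym; trans; cong; cong₂; subst; subst₂; module ≡-Reasoning)
import Relation.Binary.PropositionalEquality as ≡
open import Relation.Nullary using (Dec; yes; no; contradiction)
open import Relation.Nullary.Decidable
  using (⌊_⌋; ⌊⌋-map′; isYes≗does; does-⇔; toWitness; fromWitness; _×-dec_)
open import Relation.Unary using (Decidable)

[_]ᵘ : ℕ → ℚᵘ
[ k ]ᵘ = mkℚᵘ (+ k) 0

-- fromℕ k is definitionally fromℚᵘ [ k ]ᵘ, so its arithmetic reduces to integer arithmetic in ℚᵘ.
fromℕ : ℕ → ℚ
fromℕ k = + k / 1

fromℚᵘ-homo-+ : ∀ p q → fromℚᵘ (p ℚᵘ.+ q) ≡ fromℚᵘ p + fromℚᵘ q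
fromℚᵘ-homo-+ p q = ℚ.toℚᵘ-injective (begin
  ℚ.toℚᵘ (fromℚᵘ (p ℚᵘ.+ q))                 ≈⟨ ℚ.toℚᵘ-fromℚᵘ (p ℚᵘ.+ q) ⟩
  p ℚᵘ.+ q                                    ≈⟨ ℚᵘ.+-cong (ℚᵘ.≃-sym (ℚ.toℚᵘ-fromℚᵘ p))
                                                           (ℚᵘ.≃-sym (ℚ.toℚᵘ-fromℚᵘ q)) ⟩
  ℚ.toℚᵘ (fromℚᵘ p) ℚᵘ.+ ℚ.toℚᵘ (fromℚᵘ q)   ≈⟨ ℚᵘ.≃-sym (ℚ.toℚᵘ-homo-+ (fromℚᵘ p) (fromℚᵘ q)) ⟩
  ℚ.toℚᵘ (fromℚᵘ p + fromℚᵘ q)                ∎)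
  where open ℚᵘ.≃-Reasoning

fromℚᵘ-homo-* : ∀ p q → fromℚᵘ (p ℚᵘ.* q) ≡ fromℚᵘ p *ℚ fromℚᵘ q
fromℚᵘ-homo-* p q = ℚ.toℚᵘ-injective (begin
  ℚ.toℚᵘ (fromℚᵘ (p ℚᵘ.* q))                 ≈⟨ ℚ.toℚᵘ-fromℚᵘ (p ℚᵘ.* q) ⟩
  p ℚᵘ.* q                                    ≈⟨ ℚᵘ.*-cong (ℚᵘ.≃-sym (ℚ.toℚᵘ-fromℚᵘ p))
                                                           (ℚᵘ.≃-sym (ℚ.toℚᵘ-fromℚᵘ q)) ⟩
  ℚ.toℚᵘ (fromℚᵘ p) ℚᵘ.* ℚ.toℚᵘ (fromℚᵘ q)   ≈⟨ ℚᵘ.≃-sym (ℚ.toℚᵘ-homo-* (fromℚᵘ p) (fromℚᵘ q)) ⟩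
  ℚ.toℚᵘ (fromℚᵘ p *ℚ fromℚᵘ q)               ∎)
  where open ℚᵘ.≃-Reasoning

fromℕ-homo-+ : ∀ a b → fromℕ (a ℕ.+ b) ≡ fromℕ a + fromℕ b
fromℕ-homo-+ a b =
  trans (ℚ.fromℚᵘ-cong {[ a ℕ.+ b ]ᵘ} {[ a ]ᵘ ℚᵘ.+ [ b ]ᵘ} (ℚᵘ.*≡* eq)) (fromℚᵘ-homo-+ [ a ]ᵘ [ b ]ᵘ)
  where
  eq : + (a ℕ.+ b) ℤ.* + 1 ≡ (+ a ℤ.* + 1 ℤ.+ + b ℤ.* + 1) ℤ.* + 1
  eq rewrite ℤ.pos-+ a b = +-unit (+ a) (+ b)
    where
    open import Data.Integer.Tactic.RingSolver using (solve-∀)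
    +-unit : ∀ i j → (i ℤ.+ j) ℤ.* + 1 ≡ (i ℤ.* + 1 ℤ.+ j ℤ.* + 1) ℤ.* + 1
    +-unit = solve-∀

fromℕ-homo-* : ∀ a b → fromℕ (a ℕ.* b) ≡ fromℕ a *ℚ fromℕ b
fromℕ-homo-* a b =
  trans (ℚ.fromℚᵘ-cong {[ a ℕ.* b ]ᵘ} {[ a ]ᵘ ℚᵘ.* [ b ]ᵘ} (ℚᵘ.*≡* (cong (ℤ._* + 1) (ℤ.pos-* a b))))
        (fromℚᵘ-homo-* [ a ]ᵘ [ b ]ᵘ)

fromℕ-nonNeg : ∀ k → 0ℚ ≤ fromℕ k
fromℕ-nonNeg k = ℚ.nonNegative⁻¹ (fromℕ k) {{ℚ.normalize-nonNeg k 1}}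

fromℕ-pos : ∀ k → 0ℚ < fromℕ (suc k)
fromℕ-pos k = ℚ.positive⁻¹ (fromℕ (suc k)) {{ℚ.normalize-pos (suc k) 1}}

fromℕ-mono-≤ : ∀ {a b} → a ℕ.≤ b → fromℕ a ≤ fromℕ b
fromℕ-mono-≤ {a} a≤b with ℕ.m≤n⇒∃[o]m+o≡n a≤b
... | d , refl = begin
  fromℕ a             ≡⟨ ℚ.+-identityʳ (fromℕ a) ⟨
  fromℕ a + 0ℚ        ≤⟨ ℚ.+-monoʳ-≤ (fromℕ a) (fromℕ-nonNeg d) ⟩
  fromℕ a + fromℕ d   ≡⟨ fromℕ-homo-+ a d ⟨
  fromℕ (a ℕ.+ d)     ∎
  where open ℚ.≤-Reasoning

fromℕ-cancel-< : ∀ {a b} → fromℕ a < fromℕ b → a ℕ.< b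
fromℕ-cancel-< {a} {b} lt = ℕ.≰⇒> (λ b≤a → ℚ.<-irrefl refl (ℚ.<-≤-trans lt (fromℕ-mono-≤ b≤a)))

fromℕ-*-/ : ∀ c k → fromℕ (suc k) *ℚ (+ c / suc k) ≡ fromℕ c
fromℕ-*-/ c k = trans (sym (fromℚᵘ-homo-* [ suc k ]ᵘ (mkℚᵘ (+ c) k)))
  (ℚ.fromℚᵘ-cong {[ suc k ]ᵘ ℚᵘ.* mkℚᵘ (+ c) k} {[ c ]ᵘ} (ℚᵘ.*≡* eq))
  where
  eq : (+ suc k ℤ.* + c) ℤ.* + 1 ≡ + c ℤ.* + (suc k ℕ.+ 0)
  eq rewrite ℕ.+-identityʳ (suc k) = cancel (+ suc k) (+ c)
    where
    open import Data.Integer.Tactic.RingSolver using (solve-∀)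
    cancel : ∀ i j → (i ℤ.* j) ℤ.* + 1 ≡ j ℤ.* i
    cancel = solve-∀

*-cancelˡ-≡-pos : ∀ {r p q} → 0ℚ < r → r *ℚ p ≡ r *ℚ q → p ≡ q
*-cancelˡ-≡-pos {r} 0<r rp≡rq = ℚ.≤-antisym (cancel (ℚ.≤-reflexive rp≡rq)) (cancel (ℚ.≤-reflexive (sym rp≡rq)))
  where
  cancel : ∀ {p q} → r *ℚ p ≤ r *ℚ q → p ≤ q
  cancel = ℚ.*-cancelˡ-≤-pos r {{ℚ.positive 0<r}}

0≤q-p : ∀ {p q} → p ≤ q → 0ℚ ≤ q - p
0≤q-p {p} {q} p≤q = subst (_≤ q - p) (ℚ.+-inverseʳ p) (ℚ.+-monoˡ-≤ (- p) p≤q)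

0≤q-p⇒p≤q : ∀ {p q} → 0ℚ ≤ q - p → p ≤ q
0≤q-p⇒p≤q {p} {q} 0≤q-p = subst₂ _≤_ (ℚ.+-identityˡ p) (cancel p q) (ℚ.+-monoˡ-≤ p 0≤q-p)
  where
  cancel : ∀ p q → q - p + p ≡ q
  cancel = solve 2 (λ p q → q :- p :+ p := q) refl

0≤+ : ∀ {p q} → 0ℚ ≤ p → 0ℚ ≤ q → 0ℚ ≤ p + q
0≤+ {p} {q} 0≤p 0≤q = ℚ.≤-trans (ℚ.≤-reflexive (sym (ℚ.+-identityʳ 0ℚ))) (ℚ.+-mono-≤ 0≤p 0≤q)

0≤* : ∀ {p q} → 0ℚ ≤ p → 0ℚ ≤ q → 0ℚ ≤ p *ℚ q
0≤* {p} {q} 0≤p 0≤q = ℚ.nonNegative⁻¹ (p *ℚ q)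
  {{ℚ.nonNeg*nonNeg⇒nonNeg p {{ℚ.nonNegative 0≤p}} q {{ℚ.nonNegative 0≤q}}}}

-∣p∣≤p : ∀ p → - ℚ.∣ p ∣ ≤ p
-∣p∣≤p p with ℚ.∣p∣≡p∨∣p∣≡-p p
... | inj₁ ∣p∣≡p = ℚ.≤-trans (ℚ.neg-antimono-≤ (ℚ.0≤∣p∣ p)) (subst (0ℚ ≤_) ∣p∣≡p (ℚ.0≤∣p∣ p))
... | inj₂ ∣p∣≡-p = ℚ.≤-reflexive (trans (cong -_ ∣p∣≡-p) (⁻¹-involutive ℚ.+-0-group p))

∣p∣≤q⇒-q≤p : ∀ {p q} → ℚ.∣ p ∣ ≤ q → - q ≤ p
∣p∣≤q⇒-q≤p {p} ∣p∣≤q = ℚ.≤-trans (ℚ.neg-antimono-≤ ∣p∣≤q) (-∣p∣≤p p)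

-- Multiply through by N > 0: N (s + ε t) - N r is the sum of the four non-negative terms of `certificate`.
perturbation-≥ : ∀ {N K k b ε r s t} → 0ℚ < N → N ≤ K → 0ℚ ≤ k → 0ℚ ≤ ε →
                 ε *ℚ (b *ℚ K) ≤ 1ℚ → ℚ.∣ t ∣ ≤ k *ℚ b → N *ℚ r + k ≤ N *ℚ s →
                 r ≤ s + ε *ℚ t
perturbation-≥ {N} {K} {k} {b} {ε} {r} {s} {t} 0<N N≤K 0≤k 0≤ε εbK≤1 ∣t∣≤kb gap =
  ℚ.*-cancelˡ-≤-pos N {{ℚ.positive 0<N}} (0≤q-p⇒p≤q (subst (0ℚ ≤_) (sym certificate)
    (0≤+ (0≤+ (0≤+ (0≤q-p gap) (0≤* 0≤k (0≤q-p εbK≤1)))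
              (0≤* (0≤* 0≤ε 0≤kb) (0≤q-p N≤K)))
         (0≤* (0≤* 0≤ε (ℚ.<⇒≤ 0<N)) (0≤q-p (∣p∣≤q⇒-q≤p ∣t∣≤kb))))))
  where
  0≤kb : 0ℚ ≤ k *ℚ b
  0≤kb = ℚ.≤-trans (ℚ.0≤∣p∣ t) ∣t∣≤kb
  certificate : N *ℚ (s + ε *ℚ t) - N *ℚ r ≡
    ((N *ℚ s - (N *ℚ r + k)) + k *ℚ (1ℚ - ε *ℚ (b *ℚ K)))
    + (ε *ℚ (k *ℚ b)) *ℚ (K - N) + (ε *ℚ N) *ℚ (t - - (k *ℚ b))
  certificate = solve 8 (λ N K k b ε r s t → N :* (s :+ ε :* t) :- N :* r :=
    ((N :* s :- (N :* r :+ k)) :+ k :* (con 1ℚ :- ε :* (b :* K)))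
    :+ (ε :* (k :* b)) :* (K :- N) :+ (ε :* N) :* (t :- :- (k :* b))) refl N K k b ε r s t

iverson : Bool → ℕ
iverson b = if b then 1 else 0

iversonℚ : Bool → ℚ
iversonℚ b = if b then 1ℚ else 0ℚ

iversonℚ≡fromℕ∘iverson : ∀ b → iversonℚ b ≡ fromℕ (iverson b)
iversonℚ≡fromℕ∘iverson true  = refl
iversonℚ≡fromℕ∘iverson false = refl

_∈ᵇ_ : ∀ {k} → Fin k → Subset k → Bool
i ∈ᵇ p = ⌊ i Subset.∈? p ⌋

∈ᵇ-lookup : ∀ {k} (i : Fin k) (p : Subset k) → i ∈ᵇ p ≡ Vec.lookup p i
∈ᵇ-lookup fzero    (Subset.inside  Vec.∷ p) = refl
∈ᵇ-lookup fzero    (Subset.outside Vec.∷ p) = refl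
∈ᵇ-lookup (fsuc i) (s Vec.∷ p)              = trans (⌊⌋-map′ _ _ (i Subset.∈? p)) (∈ᵇ-lookup i p)

∈ᵇ-tabulate : ∀ {k} (g : Fin k → Bool) i →
              i ∈ᵇ Vec.tabulate (λ j → if g j then Subset.inside else Subset.outside) ≡ g i
∈ᵇ-tabulate g i = trans (∈ᵇ-lookup i _) (trans (Vec.lookup∘tabulate _ i) (if-id (g i)))
  where
  if-id : ∀ b → (if b then Subset.inside else Subset.outside) ≡ b
  if-id true  = refl
  if-id false = refl

∈ᵇ-⁅⁆ : ∀ {k} (i v : Fin k) → i ∈ᵇ Subset.⁅ v ⁆ ≡ ⌊ i Fin.≟ v ⌋
∈ᵇ-⁅⁆ i v = trans (isYes≗does (i Subset.∈? Subset.⁅ v ⁆))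
  (trans (does-⇔ Subset.x∈⁅y⁆⇔x≡y (i Subset.∈? Subset.⁅ v ⁆) (i Fin.≟ v)) (sym (isYes≗does (i Fin.≟ v))))

iversonℚ-xor : ∀ {k} (a b v : Fin k) → a ≢ b →
               iversonℚ (⌊ a Fin.≟ v ⌋ xor ⌊ b Fin.≟ v ⌋) ≡ iversonℚ ⌊ a Fin.≟ v ⌋ + iversonℚ ⌊ b Fin.≟ v ⌋
iversonℚ-xor a b v a≢b with a Fin.≟ v | b Fin.≟ v
... | yes refl | yes refl = contradiction refl a≢b
... | yes _    | no _     = refl
... | no _     | yes _    = refl
... | no _     | no _     = refl

≟-disjoint : ∀ {k} {a b : Fin k} → a ≢ b → ∀ v → ⌊ a Fin.≟ v ⌋ ∧ ⌊ b Fin.≟ v ⌋ ≡ false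
≟-disjoint {a = a} {b} a≢b v with a Fin.≟ v | b Fin.≟ v
... | yes refl | yes refl = contradiction refl a≢b
... | yes _    | no _     = refl
... | no _     | _        = refl

length-filter-∷ : ∀ {a p} {A : Set a} {P : A → Set p} (P? : Decidable P) x xs →
                  List.length (List.filter P? (x List.∷ xs)) ≡ iverson ⌊ P? x ⌋ ℕ.+ List.length (List.filter P? xs)
length-filter-∷ P? x xs with P? x
... | yes _ = refl
... | no _  = refl

allB≡all : ∀ {A : Set} (p : A → Bool) xs → allB p xs ≡ Bool.all p xs
allB≡all p List.[]        = refl
allB≡all p (x List.∷ xs) = cong (p x ∧_) (allB≡all p xs)

unique⇒lookup-injective : ∀ {a} {A : Set a} {xs : List A} → Unique xs →
                          ∀ {i j} → List.lookup xs i ≡ List.lookup xs j → i ≡ j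
unique⇒lookup-injective {xs = x List.∷ xs} (x∉xs ∷ u) {fzero}  {fzero}  _ = refl
unique⇒lookup-injective {xs = x List.∷ xs} (x∉xs ∷ u) {fzero}  {fsuc j} eq =
  ⊥-elim (All.lookup x∉xs (∈-lookup j) eq)
unique⇒lookup-injective {xs = x List.∷ xs} (x∉xs ∷ u) {fsuc i} {fzero}  eq =
  ⊥-elim (All.lookup x∉xs (∈-lookup i) (sym eq))
unique⇒lookup-injective {xs = x List.∷ xs} (x∉xs ∷ u) {fsuc i} {fsuc j} eq =
  cong fsuc (unique⇒lookup-injective u eq)

unique⇒length≤ : ∀ {a} {A : Set a} {xs ys : List A} → Unique xs → xs ⊆ ys → List.length xs ℕ.≤ List.length ys
unique⇒length≤ {A = A} {xs} u xs⊆ys = Fin.injective⇒≤ {f = position} injective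
  where
  position : Fin (List.length xs) → Fin _
  position i = Any.index (xs⊆ys (∈-lookup i))
  injective : ∀ {i j} → position i ≡ position j → i ≡ j
  injective eq = unique⇒lookup-injective u
    (Membership.index-injective (≡.setoid A) (xs⊆ys (∈-lookup _)) (xs⊆ys (∈-lookup _)) eq)

unique⇒length≤n : ∀ {n} {vs : List (Fin n)} → Unique vs → List.length vs ℕ.≤ n
unique⇒length≤n {n} {vs} u =
  subst (List.length vs ℕ.≤_) (List.length-tabulate {n = n} id) (unique⇒length≤ u (λ _ → ∈-allFin _))

n≤2*n : ∀ n → n ℕ.≤ 2 * n
n≤2*n n = ℕ.m≤m+n n (n ℕ.+ 0)

odd⇒%2≡1 : ∀ {k} → ¬ 2 ∣ k → k ℕ.% 2 ≡ 1
odd⇒%2≡1 {k} ¬2∣k with k ℕ.% 2 | ℕ.m%n<n k 2 | ℕ.m%n≡0⇒n∣m k 2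
... | 0 | _ | 2∣k = ⊥-elim (¬2∣k (2∣k refl))
... | 1 | _ | _   = refl
... | suc (suc _) | ℕ.s≤s (ℕ.s≤s ()) | _

odd+odd : ∀ {a b} → ¬ 2 ∣ a → ¬ 2 ∣ b → 2 ∣ a ℕ.+ b
odd+odd {a} {b} ¬2∣a ¬2∣b = ℕ.m%n≡0⇒n∣m (a ℕ.+ b) 2 (begin
  (a ℕ.+ b) ℕ.% 2                ≡⟨ ℕ.%-distribˡ-+ a b 2 ⟩
  (a ℕ.% 2 ℕ.+ b ℕ.% 2) ℕ.% 2    ≡⟨ cong₂ (λ x y → (x ℕ.+ y) ℕ.% 2) (odd⇒%2≡1 ¬2∣a) (odd⇒%2≡1 ¬2∣b) ⟩
  0                              ∎)
  where open ≡-Reasoning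

odd≤1⇒≡1 : ∀ {k} → k ℕ.≤ 1 → ¬ 2 ∣ k → k ≡ 1
odd≤1⇒≡1 {0} _ ¬2∣0 = contradiction (ℕ._∣0 2) ¬2∣0
odd≤1⇒≡1 {1} _ _    = refl
odd≤1⇒≡1 {suc (suc _)} (ℕ.s≤s ()) _

sum-of-odds : ∀ xs → All.All (λ k → ¬ 2 ∣ k) xs → ∃ λ J → ℕ.sum xs ≡ List.length xs ℕ.+ 2 * J
sum-of-odds List.[]        All.[]             = 0 , refl
sum-of-odds (k List.∷ ks) (¬2∣k All.∷ odds) with sum-of-odds ks odds
... | J , sum≡ = k ℕ./ 2 ℕ.+ J , (begin
  k ℕ.+ ℕ.sum ks                                 ≡⟨ cong₂ ℕ._+_ (ℕ.m≡m%n+[m/n]*n k 2) sum≡ ⟩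
  (k ℕ.% 2 ℕ.+ k ℕ./ 2 * 2) ℕ.+ (List.length ks ℕ.+ 2 * J)
    ≡⟨ cong (λ r → (r ℕ.+ k ℕ./ 2 * 2) ℕ.+ (List.length ks ℕ.+ 2 * J)) (odd⇒%2≡1 ¬2∣k) ⟩
  (1 ℕ.+ k ℕ./ 2 * 2) ℕ.+ (List.length ks ℕ.+ 2 * J) ≡⟨ rearrange (k ℕ./ 2) (List.length ks) J ⟩
  suc (List.length ks) ℕ.+ 2 * (k ℕ./ 2 ℕ.+ J)      ∎)
  where
  open ≡-Reasoning
  open import Data.Nat.Tactic.RingSolver using (solve-∀)
  rearrange : ∀ q l j → (1 ℕ.+ q * 2) ℕ.+ (l ℕ.+ 2 * j) ≡ suc l ℕ.+ 2 * (q ℕ.+ j)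
  rearrange = solve-∀

sum-map-ones : ∀ {A : Set} (f : A → ℕ) xs → All.All (λ x → f x ≡ 1) xs → ℕ.sum (List.map f xs) ≡ List.length xs
sum-map-ones f List.[]        All.[]           = refl
sum-map-ones f (x List.∷ xs) (fx≡1 All.∷ ones) = cong₂ ℕ._+_ fx≡1 (sum-map-ones f xs ones)

n<n+2j⇒n+2≤n+2j : ∀ n j → n ℕ.< n ℕ.+ 2 * j → n ℕ.+ 2 ℕ.≤ n ℕ.+ 2 * j
n<n+2j⇒n+2≤n+2j n zero    n<n+0 = contradiction (subst (n ℕ.<_) (ℕ.+-identityʳ n) n<n+0) (ℕ.<-irrefl refl)
n<n+2j⇒n+2≤n+2j n (suc j) _     = ℕ.+-monoʳ-≤ n (ℕ.*-monoʳ-≤ 2 (ℕ.s≤s ℕ.z≤n))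

module ℕΣ = SemiringSum ℕ.+-*-semiring
module ℚΣ = SemiringSum (Ring.semiring ℚ.+-*-ring)

module _ {c ℓ} (R : Semiring c ℓ) where
  open Semiring R using (Carrier; 0#; _≈_; +-congˡ; +-identityˡ; +-identityʳ; setoid)
    renaming (_+_ to _⊕_)
  open SemiringSum R using (sum; sum-cong-≗; sum-replicate-zero)
  open import Relation.Binary.Reasoning.Setoid setoid

  sum-pick : ∀ {m} (j : Fin m) (g : Fin m → Carrier) →
             sum (λ i → if ⌊ j Fin.≟ i ⌋ then g i else 0#) ≈ g j
  sum-pick {suc m} fzero g = begin
    g fzero ⊕ sum {m} (λ _ → 0#)  ≈⟨ +-congˡ (sum-replicate-zero m) ⟩
    g fzero ⊕ 0#                  ≈⟨ +-identityʳ (g fzero) ⟩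
    g fzero                       ∎
  sum-pick {suc m} (fsuc j) g = begin
    0# ⊕ sum (λ i → if ⌊ fsuc j Fin.≟ fsuc i ⌋ then g (fsuc i) else 0#)
      ≈⟨ +-identityˡ _ ⟩
    sum (λ i → if ⌊ fsuc j Fin.≟ fsuc i ⌋ then g (fsuc i) else 0#)
      ≡⟨ sum-cong-≗ (λ i → cong (if_then g (fsuc i) else 0#) (⌊⌋-map′ _ _ (j Fin.≟ i))) ⟩
    sum (λ i → if ⌊ j Fin.≟ i ⌋ then g (fsuc i) else 0#)
      ≈⟨ sum-pick j (g ∘ fsuc) ⟩
    g (fsuc j) ∎

countℕ≡sum : ∀ {k} (p : Fin k → Bool) → countℕ p ≡ ℕΣ.sum (iverson ∘ p)
countℕ≡sum {zero}  p = refl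
countℕ≡sum {suc k} p = cong (iverson (p fzero) ℕ.+_) (countℕ≡sum (p ∘ fsuc))

countℕ≡0 : ∀ {k} (p : Fin k → Bool) → (∀ i → ¬ T (p i)) → countℕ p ≡ 0
countℕ≡0 {zero}  p _ = refl
countℕ≡0 {suc k} p none with p fzero in p0
... | true  = contradiction (subst T (sym p0) tt) (none fzero)
... | false = countℕ≡0 (p ∘ fsuc) (none ∘ fsuc)

countℕ≡0⇒ : ∀ {k} (p : Fin k → Bool) → countℕ p ≡ 0 → ∀ i → ¬ T (p i)
countℕ≡0⇒ {suc k} p c i with p fzero in p0
countℕ≡0⇒ {suc k} p () i        | true
countℕ≡0⇒ {suc k} p c  fzero    | false = λ p0′ → subst T p0 p0′
countℕ≡0⇒ {suc k} p c  (fsuc j) | false = countℕ≡0⇒ (p ∘ fsuc) c j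

countℕ≡1⇒unique : ∀ {k} (p : Fin k → Bool) → countℕ p ≡ 1 → ∃ λ i → T (p i) × (∀ j → T (p j) → j ≡ i)
countℕ≡1⇒unique {suc k} p c with p fzero in p0
... | true = fzero , subst T (sym p0) tt , only-fzero
  where
  only-fzero : ∀ j → T (p j) → j ≡ fzero
  only-fzero fzero    _  = refl
  only-fzero (fsuc j) pj = contradiction pj (countℕ≡0⇒ (p ∘ fsuc) (ℕ.suc-injective c) j)
... | false with countℕ≡1⇒unique (p ∘ fsuc) c
...   | i , pi , only-i = fsuc i , pi , only-fsuc-i
  where
  only-fsuc-i : ∀ j → T (p j) → j ≡ fsuc i
  only-fsuc-i fzero    p0′ = contradiction (subst T p0 p0′) id
  only-fsuc-i (fsuc j) pj  = cong fsuc (only-i j pj)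

unique⇒countℕ≡1 : ∀ {k} (p : Fin k → Bool) {i} → T (p i) → (∀ j → T (p j) → j ≡ i) → countℕ p ≡ 1
unique⇒countℕ≡1 {suc k} p {fzero} pi only-i with p fzero in p0
... | true  = cong suc (countℕ≡0 (p ∘ fsuc) (λ j pj → contradiction (only-i (fsuc j) pj) λ ()))
... | false = ⊥-elim pi
unique⇒countℕ≡1 {suc k} p {fsuc i} pi only-i with p fzero in p0
... | true  = contradiction (only-i fzero (subst T (sym p0) tt)) λ ()
... | false = unique⇒countℕ≡1 (p ∘ fsuc) pi (λ j pj → Fin.suc-injective (only-i (fsuc j) pj))

∣p∣≡sum : ∀ {k} (p : Subset k) → ∣ p ∣ ≡ ℕΣ.sum (λ i → iverson (i ∈ᵇ p))
∣p∣≡sum {zero}  Vec.[]        = refl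
∣p∣≡sum {suc k} (s Vec.∷ p) = trans (head s) (cong (iverson (fzero ∈ᵇ (s Vec.∷ p)) ℕ.+_)
  (trans (∣p∣≡sum p) (ℕΣ.sum-cong-≗ (λ i → cong iverson (sym (⌊⌋-map′ _ _ (i Subset.∈? p)))))))
  where
  head : ∀ s → ∣ s Vec.∷ p ∣ ≡ iverson (fzero ∈ᵇ (s Vec.∷ p)) ℕ.+ ∣ p ∣
  head Subset.inside  = refl
  head Subset.outside = refl

Σℚ≡sum : ∀ {k} (f : Fin k → ℚ) → Σℚ f ≡ ℚΣ.sum f
Σℚ≡sum {zero}  f = refl
Σℚ≡sum {suc k} f = cong (_+_ (f fzero)) (Σℚ≡sum (f ∘ fsuc))

Σℚ-cong : ∀ {k} {f g : Fin k → ℚ} → (∀ i → f i ≡ g i) → Σℚ f ≡ Σℚ g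
Σℚ-cong {f = f} {g} f≗g = trans (Σℚ≡sum f) (trans (ℚΣ.sum-cong-≗ f≗g) (sym (Σℚ≡sum g)))

Σℚ-+ : ∀ {k} (f g : Fin k → ℚ) → Σℚ (λ i → f i + g i) ≡ Σℚ f + Σℚ g
Σℚ-+ f g = trans (Σℚ≡sum (λ i → f i + g i))
  (trans (ℚΣ.∑-distrib-+ f g) (sym (cong₂ _+_ (Σℚ≡sum f) (Σℚ≡sum g))))

Σℚ-* : ∀ {k} c (f : Fin k → ℚ) → Σℚ (λ i → c *ℚ f i) ≡ c *ℚ Σℚ f
Σℚ-* c f = trans (Σℚ≡sum (λ i → c *ℚ f i))
  (trans (sym (ℚΣ.*-distribˡ-sum c f)) (cong (c *ℚ_) (sym (Σℚ≡sum f))))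

Σℚ-neg : ∀ {k} (f : Fin k → ℚ) → Σℚ (λ i → - f i) ≡ - Σℚ f
Σℚ-neg {zero}  f = refl
Σℚ-neg {suc k} f =
  trans (cong (_+_ (- f fzero)) (Σℚ-neg (f ∘ fsuc))) (sym (ℚ.neg-distrib-+ (f fzero) (Σℚ (f ∘ fsuc))))

fromℕ-sum : ∀ {k} (f : Fin k → ℕ) → fromℕ (ℕΣ.sum f) ≡ Σℚ (fromℕ ∘ f)
fromℕ-sum {zero}  f = refl
fromℕ-sum {suc k} f =
  trans (fromℕ-homo-+ (f fzero) _) (cong (_+_ (fromℕ (f fzero))) (fromℕ-sum (f ∘ fsuc)))

module _ {n} (G : RawGraph n) where

  private
    restrict : ESet G → EVec G → EVec G
    restrict F a e = if e ∈ᵇ F then a e else 0ℚ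

  setSum-cong : ∀ {a b : EVec G} F → (∀ e → a e ≡ b e) → setSum G a F ≡ setSum G b F
  setSum-cong F a≗b = Σℚ-cong (λ e → cong (λ z → if e ∈ᵇ F then z else 0ℚ) (a≗b e))

  setSum-+ : ∀ (a b : EVec G) F → setSum G (λ e → a e + b e) F ≡ setSum G a F + setSum G b F
  setSum-+ a b F = trans (Σℚ-cong (λ e → split (e ∈ᵇ F) {a e} {b e})) (Σℚ-+ (restrict F a) (restrict F b))
    where
    split : ∀ t {x y} → (if t then x + y else 0ℚ) ≡ (if t then x else 0ℚ) + (if t then y else 0ℚ)
    split true  = refl
    split false = refl

  setSum-* : ∀ c (a : EVec G) F → setSum G (λ e → c *ℚ a e) F ≡ c *ℚ setSum G a F
  setSum-* c a F = trans (Σℚ-cong (λ e → split (e ∈ᵇ F) {a e})) (Σℚ-* c (restrict F a))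
    where
    split : ∀ t {x} → (if t then c *ℚ x else 0ℚ) ≡ c *ℚ (if t then x else 0ℚ)
    split true  = refl
    split false = sym (ℚ.*-zeroʳ c)

  setSum-neg : ∀ (a : EVec G) F → setSum G (λ e → - a e) F ≡ - setSum G a F
  setSum-neg a F = trans (Σℚ-cong (λ e → split (e ∈ᵇ F) {a e})) (Σℚ-neg (restrict F a))
    where
    split : ∀ t {x} → (if t then - x else 0ℚ) ≡ - (if t then x else 0ℚ)
    split true  = refl
    split false = refl

  setSum-zero : ∀ F → setSum G (λ _ → 0ℚ) F ≡ 0ℚ
  setSum-zero F =
    trans (Σℚ-cong (λ e → split (e ∈ᵇ F))) (trans (Σℚ≡sum {m G} (λ _ → 0ℚ)) (ℚΣ.sum-replicate-zero (m G)))
    where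
    split : ∀ t → (if t then 0ℚ else 0ℚ) ≡ 0ℚ
    split true  = refl
    split false = refl

  setSum-unit : ∀ f F → setSum G (λ e → iversonℚ ⌊ f Fin.≟ e ⌋) F ≡ iversonℚ (f ∈ᵇ F)
  setSum-unit f F = trans (Σℚ-cong (λ e → swap (e ∈ᵇ F) ⌊ f Fin.≟ e ⌋))
    (trans (Σℚ≡sum (λ e → if ⌊ f Fin.≟ e ⌋ then iversonℚ (e ∈ᵇ F) else 0ℚ))
      (sum-pick (Ring.semiring ℚ.+-*-ring) f (λ e → iversonℚ (e ∈ᵇ F))))
    where
    swap : ∀ s t → (if s then iversonℚ t else 0ℚ) ≡ (if t then iversonℚ s else 0ℚ)
    swap true  true  = refl
    swap true  false = refl
    swap false true  = refl
    swap false false = refl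

-- Alternating vectors

sign : ℕ → ℚ
sign zero    = 1ℚ
sign (suc k) = - sign k

sign-even : ∀ {k} → 2 ∣ k → sign k ≡ 1ℚ
sign-even {0}           _   = refl
sign-even {1}           2∣1 = contradiction (ℕ.∣1⇒≡1 2∣1) λ ()
sign-even {suc (suc k)} 2∣k+2 =
  trans (⁻¹-involutive ℚ.+-0-group (sign k)) (sign-even (ℕ.∣m+n∣m⇒∣n 2∣k+2 ℕ.∣-refl))

occurrences : ∀ {k} → Fin k → List (Fin k) → ℕ
occurrences e = List.length ∘ List.filter (Fin._≟ e)

occurrences-++ : ∀ {k} (e : Fin k) xs ys → occurrences e (xs List.++ ys) ≡ occurrences e xs ℕ.+ occurrences e ys
occurrences-++ e xs ys =
  trans (cong List.length (List.filter-++ (Fin._≟ e) xs ys)) (List.length-++ (List.filter (Fin._≟ e) xs))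

occurrences≤length : ∀ {k} (e : Fin k) xs → occurrences e xs ℕ.≤ List.length xs
occurrences≤length e = List.length-filter (Fin._≟ e)

occurrences-∉ : ∀ {k} {e : Fin k} {xs} → ¬ e ∈ xs → occurrences e xs ≡ 0
occurrences-∉ {e = e} e∉xs =
  cong List.length (List.filter-none (Fin._≟ e) (All.map (_∘ sym) (All.¬Any⇒All¬ _ e∉xs)))

∣-ι-q∣≤ι+c : ∀ b q {c} → ℚ.∣ q ∣ ≤ c → ℚ.∣ - iversonℚ b - q ∣ ≤ iversonℚ b + c
∣-ι-q∣≤ι+c b q ∣q∣≤c =
  ℚ.≤-trans (ℚ.∣p-q∣≤∣p∣+∣q∣ (- iversonℚ b) q) (ℚ.+-mono-≤ (ℚ.≤-reflexive (∣-ι∣ b)) ∣q∣≤c)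
  where
  ∣-ι∣ : ∀ b → ℚ.∣ - iversonℚ b ∣ ≡ iversonℚ b
  ∣-ι∣ true  = refl
  ∣-ι∣ false = refl

module _ {n} (G : RawGraph n) where

  χ-∉ : ∀ {e} W → ¬ e ∈ W → χ G W e ≡ 0ℚ
  χ-∉ List.[] _ = refl
  χ-∉ {e} (f List.∷ W) e∉f∷W with f Fin.≟ e
  ... | yes refl = ⊥-elim (e∉f∷W (here refl))
  ... | no _     = cong (λ z → - 0ℚ - z) (χ-∉ W (e∉f∷W ∘ there))

  setSum-χ-∷ : ∀ f W F → setSum G (χ G (f List.∷ W)) F ≡ - iversonℚ (f ∈ᵇ F) - setSum G (χ G W) F
  setSum-χ-∷ f W F = trans (setSum-+ G (λ e → - iversonℚ ⌊ f Fin.≟ e ⌋) (λ e → - χ G W e) F)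
    (cong₂ _+_ (trans (setSum-neg G _ F) (cong -_ (setSum-unit G f F))) (setSum-neg G (χ G W) F))

  ∣setSum-χ∣≤length : ∀ W F → ℚ.∣ setSum G (χ G W) F ∣ ≤ fromℕ (List.length W)
  ∣setSum-χ∣≤length List.[]       F = ℚ.≤-reflexive (cong ℚ.∣_∣ (setSum-zero G F))
  ∣setSum-χ∣≤length (f List.∷ W) F = begin
    ℚ.∣ setSum G (χ G (f List.∷ W)) F ∣              ≡⟨ cong ℚ.∣_∣ (setSum-χ-∷ f W F) ⟩
    ℚ.∣ - iversonℚ (f ∈ᵇ F) - setSum G (χ G W) F ∣   ≤⟨ ∣-ι-q∣≤ι+c (f ∈ᵇ F) _ (∣setSum-χ∣≤length W F) ⟩
    iversonℚ (f ∈ᵇ F) + fromℕ (List.length W)        ≤⟨ ℚ.+-monoˡ-≤ _ (ι≤1 (f ∈ᵇ F)) ⟩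
    1ℚ + fromℕ (List.length W)                       ≡⟨ fromℕ-homo-+ 1 (List.length W) ⟨
    fromℕ (List.length (f List.∷ W))                 ∎
    where
    open ℚ.≤-Reasoning
    ι≤1 : ∀ b → iversonℚ b ≤ 1ℚ
    ι≤1 true  = ℚ.≤-refl
    ι≤1 false = fromℕ-nonNeg 1

  ∣χ∣≤occurrences : ∀ W e → ℚ.∣ χ G W e ∣ ≤ fromℕ (occurrences e W)
  ∣χ∣≤occurrences List.[]       e = ℚ.≤-refl
  ∣χ∣≤occurrences (f List.∷ W) e = begin
    ℚ.∣ - ι - χ G W e ∣                        ≤⟨ ∣-ι-q∣≤ι+c f≟e (χ G W e) (∣χ∣≤occurrences W e) ⟩
    ι + fromℕ (occurrences e W)                ≡⟨ cong (_+ fromℕ (occurrences e W)) (iversonℚ≡fromℕ∘iverson f≟e) ⟩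
    fromℕ (iverson f≟e) + fromℕ (occurrences e W) ≡⟨ fromℕ-homo-+ (iverson f≟e) (occurrences e W) ⟨
    fromℕ (iverson f≟e ℕ.+ occurrences e W)    ≡⟨ cong fromℕ (length-filter-∷ (Fin._≟ e) f W) ⟨
    fromℕ (occurrences e (f List.∷ W))         ∎
    where
    open ℚ.≤-Reasoning
    f≟e = ⌊ f Fin.≟ e ⌋
    ι = iversonℚ f≟e

-- Walks

length-dumbbell : ∀ {A : Set} (C₁ C₂ P : List A) →
                  List.length (C₁ List.++ P List.++ C₂ List.++ List.reverse P)
                  ≡ (List.length C₁ ℕ.+ List.length C₂) ℕ.+ 2 * List.length P
length-dumbbell C₁ C₂ P = begin
  List.length (C₁ List.++ P List.++ C₂ List.++ List.reverse P)
    ≡⟨ List.length-++ C₁ ⟩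
  List.length C₁ ℕ.+ List.length (P List.++ C₂ List.++ List.reverse P)
    ≡⟨ cong (List.length C₁ ℕ.+_) (List.length-++ P) ⟩
  List.length C₁ ℕ.+ (List.length P ℕ.+ List.length (C₂ List.++ List.reverse P))
    ≡⟨ cong (λ l → List.length C₁ ℕ.+ (List.length P ℕ.+ l))
            (trans (List.length-++ C₂) (cong (List.length C₂ ℕ.+_) (List.length-reverse P))) ⟩
  List.length C₁ ℕ.+ (List.length P ℕ.+ (List.length C₂ ℕ.+ List.length P))
    ≡⟨ rearrange (List.length C₁) (List.length C₂) (List.length P) ⟩
  (List.length C₁ ℕ.+ List.length C₂) ℕ.+ 2 * List.length P ∎
  where
  open ≡-Reasoning
  open import Data.Nat.Tactic.RingSolver using (solve-∀)
  rearrange : ∀ c₁ c₂ p → c₁ ℕ.+ (p ℕ.+ (c₂ ℕ.+ p)) ≡ (c₁ ℕ.+ c₂) ℕ.+ 2 * p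
  rearrange = solve-∀

dumbbell-even : ∀ {A : Set} {C₁ C₂ P : List A} → OddLen C₁ → OddLen C₂ →
                EvenLen (C₁ List.++ P List.++ C₂ List.++ List.reverse P)
dumbbell-even {C₁ = C₁} {C₂} {P} o₁ o₂ = subst (2 ∣_) (sym (length-dumbbell C₁ C₂ P))
  (ℕ.∣m∣n⇒∣m+n (odd+odd o₁ o₂) (ℕ.m∣m*n (List.length P)))

module _ {n} (G : RawGraph n) where

  data Trail : Fin n → Fin n → List (Fin (m G)) → Set where
    []  : ∀ {a} → Trail a a List.[]
    _∷_ : ∀ {a b c e es} → Joins G e a b → Trail b c es → Trail a c (e List.∷ es)

  walk⇒trail : ∀ {a b} vs {es} → Walk G (a List.∷ vs List.++ List.[ b ]) es → Trail a b es
  walk⇒trail List.[]        (step _ a~b (stop _)) = a~b ∷ []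
  walk⇒trail (v List.∷ vs) (step _ a~v w)        = a~v ∷ walk⇒trail vs w

  trail-++ : ∀ {a b c es fs} → Trail a b es → Trail b c fs → Trail a c (es List.++ fs)
  trail-++ []        t′ = t′
  trail-++ (a~b ∷ t) t′ = a~b ∷ trail-++ t t′

  trail-reverse : ∀ {a b es} → Trail a b es → Trail b a (List.reverse es)
  trail-reverse [] = []
  trail-reverse (_∷_ {e = e} {es} a~b t) = subst (Trail _ _) (sym (List.unfold-reverse e es))
    (trail-++ (trail-reverse t) (Sum.swap a~b ∷ []))

  cycle⇒trail : ∀ {v C} → Cycle G v C → Trail v v C
  cycle⇒trail (vs , w , _) = walk⇒trail vs w

  path⇒trail : ∀ {a b P} → Path G a b P → Trail a b P
  path⇒trail (inj₁ (vs , w , _))  = walk⇒trail vs w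
  path⇒trail (inj₂ (refl , refl)) = []

  walk-length : ∀ {vs es} → Walk G vs es → List.length vs ≡ suc (List.length es)
  walk-length (stop _)     = refl
  walk-length (step _ _ w) = cong suc (walk-length w)

  cycle-length≤ : ∀ {v C} → Cycle G v C → List.length C ℕ.≤ n
  cycle-length≤ {v} {C} (vs , w , u , _) = subst (ℕ._≤ n) length-v∷vs (unique⇒length≤n u)
    where
    length-v∷vs : List.length (v List.∷ vs) ≡ List.length C
    length-v∷vs = begin
      suc (List.length vs)                          ≡⟨ ℕ.+-comm 1 (List.length vs) ⟩
      List.length vs ℕ.+ 1                          ≡⟨ List.length-++ vs ⟨
      List.length (vs List.++ List.[ v ])           ≡⟨ ℕ.suc-injective (walk-length w) ⟩
      List.length C                                 ∎
      where open ≡-Reasoning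

  path-length≤ : ∀ {a b P} → Path G a b P → List.length P ℕ.≤ n
  path-length≤ (inj₁ (vs , w , u))  = ℕ.<⇒≤ (subst (ℕ._≤ n) (walk-length w) (unique⇒length≤n u))
  path-length≤ (inj₂ (refl , refl)) = ℕ.z≤n

  evenWalk⇒closedTrail : ∀ {W} → EvenWalk G W → ∃ λ a → Trail a a W × EvenLen W
  evenWalk⇒closedTrail (evenCycle {v} c even) = v , cycle⇒trail c , even
  evenWalk⇒closedTrail (dumbbell {v₁} {C₁ = C₁} {C₂} {P} c₁ o₁ c₂ o₂ p _ _ _) =
    v₁ , trail-++ (cycle⇒trail c₁) (trail-++ (path⇒trail p)
                   (trail-++ (cycle⇒trail c₂) (trail-reverse (path⇒trail p))))
       , dumbbell-even {C₁ = C₁} {C₂} {P} o₁ o₂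

  evenWalk-length≤ : ∀ {W} → EvenWalk G W → List.length W ℕ.≤ 2 * (2 * n)
  evenWalk-length≤ (evenCycle c _) = ℕ.≤-trans (cycle-length≤ c) (ℕ.≤-trans (n≤2*n n) (n≤2*n (2 * n)))
  evenWalk-length≤ (dumbbell {C₁ = C₁} {C₂} {P} c₁ _ c₂ _ p _ _ _) = begin
    List.length (C₁ List.++ P List.++ C₂ List.++ List.reverse P)  ≡⟨ length-dumbbell C₁ C₂ P ⟩
    (List.length C₁ ℕ.+ List.length C₂) ℕ.+ 2 * List.length P
      ≤⟨ ℕ.+-mono-≤ (ℕ.+-mono-≤ (cycle-length≤ c₁) (cycle-length≤ c₂)) (ℕ.*-monoʳ-≤ 2 (path-length≤ p)) ⟩
    (n ℕ.+ n) ℕ.+ 2 * n                                          ≡⟨ four-n n ⟩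
    2 * (2 * n)                                                  ∎
    where
    open ℕ.≤-Reasoning
    open import Data.Nat.Tactic.RingSolver using (solve-∀)
    four-n : ∀ n → (n ℕ.+ n) ℕ.+ 2 * n ≡ 2 * (2 * n)
    four-n = solve-∀

  evenWalk-occurrences≤ : ∀ {W} → EvenWalk G W → ∀ e → occurrences e W ℕ.≤ 2 * n
  evenWalk-occurrences≤ (evenCycle {C = C} c _) e =
    ℕ.≤-trans (occurrences≤length e C) (ℕ.≤-trans (cycle-length≤ c) (n≤2*n n))
  evenWalk-occurrences≤ (dumbbell {C₁ = C₁} {C₂} {P} c₁ _ c₂ _ p C₁#C₂ P#C₁ P#C₂) e
    rewrite occurrences-++ e C₁ (P List.++ C₂ List.++ List.reverse P)
          | occurrences-++ e P (C₂ List.++ List.reverse P)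
          | occurrences-++ e C₂ (List.reverse P)
    with Any.any? (e Fin.≟_) C₁ | Any.any? (e Fin.≟_) P
  ... | yes e∈C₁ | _
    rewrite occurrences-∉ {xs = P} (λ e∈P → P#C₁ (e∈P , e∈C₁))
          | occurrences-∉ {xs = C₂} (λ e∈C₂ → C₁#C₂ (e∈C₁ , e∈C₂))
          | occurrences-∉ {xs = List.reverse P} (λ e∈P⁻¹ → P#C₁ (Any.reverse⁻ e∈P⁻¹ , e∈C₁))
    = ℕ.≤-trans (ℕ.≤-reflexive (ℕ.+-identityʳ _)) (ℕ.≤-trans (occurrences≤length e C₁)
                (ℕ.≤-trans (cycle-length≤ c₁) (n≤2*n n)))
  ... | no e∉C₁ | yes e∈P
    rewrite occurrences-∉ {xs = C₁} e∉C₁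
          | occurrences-∉ {xs = C₂} (λ e∈C₂ → P#C₂ (e∈P , e∈C₂))
    = ℕ.+-mono-≤ (ℕ.≤-trans (occurrences≤length e P) (path-length≤ p))
        (ℕ.≤-trans (ℕ.≤-trans (occurrences≤length e (List.reverse P)) (ℕ.≤-reflexive (List.length-reverse P)))
                   (ℕ.≤-trans (path-length≤ p) (ℕ.m≤m+n n 0)))
  ... | no e∉C₁ | no e∉P
    rewrite occurrences-∉ {xs = C₁} e∉C₁
          | occurrences-∉ {xs = P} e∉P
          | occurrences-∉ {xs = List.reverse P} (e∉P ∘ Any.reverse⁻)
    = ℕ.≤-trans (ℕ.≤-reflexive (ℕ.+-identityʳ _)) (ℕ.≤-trans (occurrences≤length e C₂)
                (ℕ.≤-trans (cycle-length≤ c₂) (n≤2*n n)))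

  evenWalk-∣χ∣≤ : ∀ {W} → EvenWalk G W → ∀ e → ℚ.∣ χ G W e ∣ ≤ fromℕ (2 * n)
  evenWalk-∣χ∣≤ {W} ew e = ℚ.≤-trans (∣χ∣≤occurrences G W e) (fromℕ-mono-≤ (evenWalk-occurrences≤ ew e))

  evenWalk-∣setSum-χ∣≤ : ∀ {W} → EvenWalk G W → ∀ F → ℚ.∣ setSum G (χ G W) F ∣ ≤ fromℕ (2 * (2 * n))
  evenWalk-∣setSum-χ∣≤ {W} ew F = ℚ.≤-trans (∣setSum-χ∣≤length G W F) (fromℕ-mono-≤ (evenWalk-length≤ ew))

module _ {n} (G : Graph n) where

  private
    R : RawGraph n
    R = raw G

  iversonℚ-∈δv : ∀ {e a b} → Joins R e a b → ∀ v →
                 iversonℚ (e ∈ᵇ δv R v) ≡ iversonℚ ⌊ a Fin.≟ v ⌋ + iversonℚ ⌊ b Fin.≟ v ⌋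
  iversonℚ-∈δv {e} {a} {b} a~b v = begin
    iversonℚ (e ∈ᵇ δv R v)
      ≡⟨ cong iversonℚ (trans (∈ᵇ-tabulate _ e)
                              (cong₂ _xor_ (∈ᵇ-⁅⁆ (proj₁ (ends R e)) v) (∈ᵇ-⁅⁆ (proj₂ (ends R e)) v))) ⟩
    iversonℚ (⌊ proj₁ (ends R e) Fin.≟ v ⌋ xor ⌊ proj₂ (ends R e) Fin.≟ v ⌋)
      ≡⟨ iversonℚ-xor _ _ v (loopless G e) ⟩
    ι-ends (ends R e)
      ≡⟨ orient a~b ⟩
    ι-ends (a , b) ∎
    where
    open ≡-Reasoning
    ι-ends : Fin n × Fin n → ℚ
    ι-ends (x , y) = iversonℚ ⌊ x Fin.≟ v ⌋ + iversonℚ ⌊ y Fin.≟ v ⌋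
    orient : Joins R e a b → ι-ends (ends R e) ≡ ι-ends (a , b)
    orient (inj₁ ends≡ab) = cong ι-ends ends≡ab
    orient (inj₂ ends≡ba) = trans (cong ι-ends ends≡ba) (ℚ.+-comm (iversonℚ ⌊ b Fin.≟ v ⌋) (iversonℚ ⌊ a Fin.≟ v ⌋))

  trail-δv : ∀ {a b es} → Trail R a b es → ∀ v →
             setSum R (χ R es) (δv R v) ≡ sign (List.length es) *ℚ iversonℚ ⌊ b Fin.≟ v ⌋ - iversonℚ ⌊ a Fin.≟ v ⌋
  trail-δv {a} [] v = trans (setSum-zero R (δv R v)) (empty (iversonℚ ⌊ a Fin.≟ v ⌋))
    where
    empty : ∀ x → 0ℚ ≡ 1ℚ *ℚ x - x
    empty = solve 1 (λ x → con 0ℚ := con 1ℚ :* x :- x) refl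
  trail-δv {a} {b} (_∷_ {b = c} {e = e} {es} a~c t) v = begin
    setSum R (χ R (e List.∷ es)) (δv R v)
      ≡⟨ setSum-χ-∷ R e es (δv R v) ⟩
    - iversonℚ (e ∈ᵇ δv R v) - setSum R (χ R es) (δv R v)
      ≡⟨ cong₂ (λ x y → - x - y) (iversonℚ-∈δv a~c v) (trail-δv t v) ⟩
    - (ιa + ιc) - (sign (List.length es) *ℚ ιb - ιc)
      ≡⟨ rearrange ιa ιb ιc (sign (List.length es)) ⟩
    - sign (List.length es) *ℚ ιb - ιa ∎
    where
    open ≡-Reasoning
    ιa = iversonℚ ⌊ a Fin.≟ v ⌋
    ιb = iversonℚ ⌊ b Fin.≟ v ⌋
    ιc = iversonℚ ⌊ c Fin.≟ v ⌋
    rearrange : ∀ x y z s → - (x + z) - (s *ℚ y - z) ≡ - s *ℚ y - x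
    rearrange = solve 4 (λ x y z s → :- (x :+ z) :- (s :* y :- z) := :- s :* y :- x) refl

  evenWalk-δv : ∀ {W} → EvenWalk R W → ∀ v → setSum R (χ R W) (δv R v) ≡ 0ℚ
  evenWalk-δv {W} ew v with evenWalk⇒closedTrail R ew
  ... | a , t , even = begin
    setSum R (χ R W) (δv R v)                   ≡⟨ trail-δv t v ⟩
    sign (List.length W) *ℚ ιa - ιa              ≡⟨ cong (λ s → s *ℚ ιa - ιa) (sign-even even) ⟩
    1ℚ *ℚ ιa - ιa                                ≡⟨ cancel ιa ⟩
    0ℚ                                           ∎
    where
    open ≡-Reasoning
    ιa = iversonℚ ⌊ a Fin.≟ v ⌋
    cancel : ∀ x → 1ℚ *ℚ x - x ≡ 0ℚ
    cancel = solve 1 (λ x → con 1ℚ :* x :- x := con 0ℚ) refl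

-- Perfect matchings and cuts

module _ {n} (G : RawGraph n) where

  isPM⇒degree≡1 : ∀ {M} → T (isPM G M) → ∀ v → degIn G M v ≡ 1
  isPM⇒degree≡1 {M} pm v = ℕ.≡ᵇ⇒≡ _ 1
    (All.lookup (All.all⁺ _ (List.allFin n) (subst T (allB≡all _ (List.allFin n)) pm)) (∈-allFin v))

  degree≡1⇒isPM : ∀ {M} → (∀ v → degIn G M v ≡ 1) → T (isPM G M)
  degree≡1⇒isPM {M} deg≡1 = subst T (sym (allB≡all _ (List.allFin n)))
    (All.all⁻ _ {List.allFin n} (All.tabulate (λ {v} _ → subst (λ d → T (d ℕ.≡ᵇ 1)) (sym (deg≡1 v)) _)))

  common-edges : ESet G → ESet G → ℕ
  common-edges M F = countℕ (λ e → e ∈ᵇ F ∧ e ∈ᵇ M)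

incidence-split : ∀ s m x y → x ∧ y ≡ false →
                  iverson s * iverson (m ∧ (x ∨ y))
                  ≡ iverson m * ((if x then iverson s else 0) ℕ.+ (if y then iverson s else 0))
incidence-split true  true  true  false _ = refl
incidence-split true  true  false true  _ = refl
incidence-split true  true  false false _ = refl
incidence-split true  false _     _     _ = refl
incidence-split false true  true  false _ = refl
incidence-split false true  false true  _ = refl
incidence-split false true  false false _ = refl
incidence-split false false _     _     _ = refl
incidence-split _     _     true  true  ()

endpoint-split : ∀ m x y → iverson m * (iverson x ℕ.+ iverson y)
                           ≡ iverson ((x xor y) ∧ m) ℕ.+ 2 * iverson (m ∧ (x ∧ y))
endpoint-split true  true  true  = refl
endpoint-split true  true  false = refl
endpoint-split true  false true  = refl
endpoint-split true  false false = refl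
endpoint-split false true  true  = refl
endpoint-split false true  false = refl
endpoint-split false false true  = refl
endpoint-split false false false = refl

module _ {n} (G : Graph n) where

  private
    R : RawGraph n
    R = raw G

  sum-incident : ∀ M S e → ℕΣ.sum (λ v → iverson (v ∈ᵇ S) * iverson (e ∈ᵇ M ∧ incident R e v))
                           ≡ iverson (e ∈ᵇ M) * (iverson (proj₁ (ends R e) ∈ᵇ S) ℕ.+ iverson (proj₂ (ends R e) ∈ᵇ S))
  sum-incident M S e = begin
    ℕΣ.sum (λ v → [ v ∈S] * iverson (e ∈ᵇ M ∧ incident R e v))
      ≡⟨ ℕΣ.sum-cong-≗ (λ v → incidence-split (v ∈ᵇ S) (e ∈ᵇ M) ⌊ a Fin.≟ v ⌋ ⌊ b Fin.≟ v ⌋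
                                                (≟-disjoint (loopless G e) v)) ⟩
    ℕΣ.sum (λ v → iverson (e ∈ᵇ M) * (pick a v ℕ.+ pick b v))
      ≡⟨ ℕΣ.*-distribˡ-sum (iverson (e ∈ᵇ M)) (λ v → pick a v ℕ.+ pick b v) ⟨
    iverson (e ∈ᵇ M) * ℕΣ.sum (λ v → pick a v ℕ.+ pick b v)
      ≡⟨ cong (iverson (e ∈ᵇ M) *_) (ℕΣ.∑-distrib-+ (pick a) (pick b)) ⟩
    iverson (e ∈ᵇ M) * (ℕΣ.sum (pick a) ℕ.+ ℕΣ.sum (pick b))
      ≡⟨ cong (iverson (e ∈ᵇ M) *_) (cong₂ ℕ._+_ (sum-pick ℕ.+-*-semiring a [_∈S])
                                                  (sum-pick ℕ.+-*-semiring b [_∈S])) ⟩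
    iverson (e ∈ᵇ M) * ([ a ∈S] ℕ.+ [ b ∈S]) ∎
    where
    open ≡-Reasoning
    a = proj₁ (ends R e)
    b = proj₂ (ends R e)
    [_∈S] : Fin n → ℕ
    [ v ∈S] = iverson (v ∈ᵇ S)
    pick : Fin n → Fin n → ℕ
    pick u v = if ⌊ u Fin.≟ v ⌋ then [ v ∈S] else 0

  -- Count the pairs (v , e) with v ∈ S, e ∈ M and v ∈ e by v and by e.
  handshake : ∀ {M} → T (isPM R M) → ∀ S → ∃ λ J → ∣ S ∣ ≡ common-edges R M (δ R S) ℕ.+ 2 * J
  handshake {M} pm S = ℕΣ.sum inside , (begin
    ∣ S ∣
      ≡⟨ ∣p∣≡sum S ⟩
    ℕΣ.sum (λ v → [ v ∈S])
      ≡⟨ ℕΣ.sum-cong-≗ (λ v → sym (trans (cong ([ v ∈S] *_) (isPM⇒degree≡1 R pm v)) (ℕ.*-identityʳ _))) ⟩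
    ℕΣ.sum (λ v → [ v ∈S] * degIn R M v)
      ≡⟨ ℕΣ.sum-cong-≗ (λ v → trans (cong ([ v ∈S] *_) (countℕ≡sum (λ e → e ∈ᵇ M ∧ incident R e v)))
                                    (ℕΣ.*-distribˡ-sum [ v ∈S] (λ e → iverson (e ∈ᵇ M ∧ incident R e v)))) ⟩
    ℕΣ.sum (λ v → ℕΣ.sum (λ e → [ v ∈S] * iverson (e ∈ᵇ M ∧ incident R e v)))
      ≡⟨ ℕΣ.∑-comm (λ v e → [ v ∈S] * iverson (e ∈ᵇ M ∧ incident R e v)) ⟩
    ℕΣ.sum (λ e → ℕΣ.sum (λ v → [ v ∈S] * iverson (e ∈ᵇ M ∧ incident R e v)))
      ≡⟨ ℕΣ.sum-cong-≗ (sum-incident M S) ⟩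
    ℕΣ.sum (λ e → iverson (e ∈ᵇ M) * ([ end₁ e ∈S] ℕ.+ [ end₂ e ∈S]))
      ≡⟨ ℕΣ.sum-cong-≗ (λ e → endpoint-split (e ∈ᵇ M) (end₁ e ∈ᵇ S) (end₂ e ∈ᵇ S)) ⟩
    ℕΣ.sum (λ e → crosses e ℕ.+ 2 * inside e)
      ≡⟨ ℕΣ.∑-distrib-+ crosses (λ e → 2 * inside e) ⟩
    ℕΣ.sum crosses ℕ.+ ℕΣ.sum (λ e → 2 * inside e)
      ≡⟨ cong₂ ℕ._+_ common≡crosses (ℕΣ.*-distribˡ-sum 2 inside) ⟨
    common-edges R M (δ R S) ℕ.+ 2 * ℕΣ.sum inside ∎)
    where
    open ≡-Reasoning
    [_∈S] : Fin n → ℕ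
    [ v ∈S] = iverson (v ∈ᵇ S)
    end₁ end₂ : Fin (m R) → Fin n
    end₁ e = proj₁ (ends R e)
    end₂ e = proj₂ (ends R e)
    crosses inside : Fin (m R) → ℕ
    crosses e = iverson ((end₁ e ∈ᵇ S xor end₂ e ∈ᵇ S) ∧ e ∈ᵇ M)
    inside e = iverson (e ∈ᵇ M ∧ (end₁ e ∈ᵇ S ∧ end₂ e ∈ᵇ S))
    common≡crosses : common-edges R M (δ R S) ≡ ℕΣ.sum crosses
    common≡crosses = trans (countℕ≡sum (λ e → e ∈ᵇ δ R S ∧ e ∈ᵇ M))
      (ℕΣ.sum-cong-≗ (λ e → cong (λ b → iverson (b ∧ e ∈ᵇ M)) (∈ᵇ-tabulate _ e)))

  common-edges-δ-odd : ∀ {M} → T (isPM R M) → ∀ S → ¬ 2 ∣ ∣ S ∣ → ¬ 2 ∣ common-edges R M (δ R S)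
  common-edges-δ-odd pm S ¬2∣S 2∣c with handshake pm S
  ... | J , ∣S∣≡c+2J = ¬2∣S (subst (2 ∣_) (sym ∣S∣≡c+2J) (ℕ.∣m∣n⇒∣m+n 2∣c (ℕ.m∣m*n J)))

  common-edges-δv : ∀ {M} → T (isPM R M) → ∀ v → common-edges R M (δv R v) ≡ 1
  common-edges-δv {M} pm v with handshake pm Subset.⁅ v ⁆
  ... | J , ∣v∣≡c+2J = odd≤1⇒≡1 c≤1 (common-edges-δ-odd pm Subset.⁅ v ⁆ ¬2∣∣v∣)
    where
    c≤1 : common-edges R M (δv R v) ℕ.≤ 1
    c≤1 = subst (common-edges R M (δv R v) ℕ.≤_) (trans (sym ∣v∣≡c+2J) (Subset.∣⁅x⁆∣≡1 v)) (ℕ.m≤m+n _ (2 * J))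
    ¬2∣∣v∣ : ¬ 2 ∣ ∣ Subset.⁅ v ⁆ ∣
    ¬2∣∣v∣ 2∣∣v∣ = contradiction (ℕ.∣1⇒≡1 (subst (2 ∣_) (Subset.∣⁅x⁆∣≡1 v) 2∣∣v∣)) λ ()

-- Averages of perfect matchings

module _ {n} (G : RawGraph n) where

  multiplicity : List (ESet G) → Fin (m G) → ℕ
  multiplicity L e = List.length (List.filter (e Subset.∈?_) L)

  sum-multiplicity : ∀ L F → ℕΣ.sum (λ e → if e ∈ᵇ F then multiplicity L e else 0)
                             ≡ ℕ.sum (List.map (λ M → common-edges G M F) L)
  sum-multiplicity List.[] F =
    trans (ℕΣ.sum-cong-≗ (λ e → zero-either (e ∈ᵇ F))) (ℕΣ.sum-replicate-zero (m G))
    where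
    zero-either : ∀ t → (if t then 0 else 0) ≡ 0
    zero-either true  = refl
    zero-either false = refl
  sum-multiplicity (M List.∷ L) F = begin
    ℕΣ.sum (λ e → if e ∈ᵇ F then multiplicity (M List.∷ L) e else 0)
      ≡⟨ ℕΣ.sum-cong-≗ (λ e → trans (cong (λ k → if e ∈ᵇ F then k else 0) (length-filter-∷ (e Subset.∈?_) M L))
                                    (split (e ∈ᵇ F) (e ∈ᵇ M))) ⟩
    ℕΣ.sum (λ e → iverson (e ∈ᵇ F ∧ e ∈ᵇ M) ℕ.+ (if e ∈ᵇ F then multiplicity L e else 0))
      ≡⟨ ℕΣ.∑-distrib-+ (λ e → iverson (e ∈ᵇ F ∧ e ∈ᵇ M)) (λ e → if e ∈ᵇ F then multiplicity L e else 0) ⟩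
    ℕΣ.sum (λ e → iverson (e ∈ᵇ F ∧ e ∈ᵇ M)) ℕ.+ ℕΣ.sum (λ e → if e ∈ᵇ F then multiplicity L e else 0)
      ≡⟨ cong₂ ℕ._+_ (sym (countℕ≡sum (λ e → e ∈ᵇ F ∧ e ∈ᵇ M))) (sum-multiplicity L F) ⟩
    common-edges G M F ℕ.+ ℕ.sum (List.map (λ M → common-edges G M F) L) ∎
    where
    open ≡-Reasoning
    split : ∀ t s {k} → (if t then iverson s ℕ.+ k else 0) ≡ iverson (t ∧ s) ℕ.+ (if t then k else 0)
    split true  s = refl
    split false s = refl

  fromℕ*setSum-avg : ∀ M L F → fromℕ (suc (List.length L)) *ℚ setSum G (avg G (M List.∷ L)) F
                               ≡ fromℕ (ℕ.sum (List.map (λ M′ → common-edges G M′ F) (M List.∷ L)))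
  fromℕ*setSum-avg M L F = begin
    N *ℚ setSum G (avg G (M List.∷ L)) F
      ≡⟨ setSum-* G N (avg G (M List.∷ L)) F ⟨
    setSum G (λ e → N *ℚ avg G (M List.∷ L) e) F
      ≡⟨ setSum-cong G F (λ e → fromℕ-*-/ (multiplicity (M List.∷ L) e) (List.length L)) ⟩
    setSum G (fromℕ ∘ multiplicity (M List.∷ L)) F
      ≡⟨ Σℚ-cong (λ e → split (e ∈ᵇ F)) ⟩
    Σℚ (λ e → fromℕ (if e ∈ᵇ F then multiplicity (M List.∷ L) e else 0))
      ≡⟨ fromℕ-sum (λ e → if e ∈ᵇ F then multiplicity (M List.∷ L) e else 0) ⟨
    fromℕ (ℕΣ.sum (λ e → if e ∈ᵇ F then multiplicity (M List.∷ L) e else 0))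
      ≡⟨ cong fromℕ (sum-multiplicity (M List.∷ L) F) ⟩
    fromℕ (ℕ.sum (List.map (λ M′ → common-edges G M′ F) (M List.∷ L))) ∎
    where
    open ≡-Reasoning
    N = fromℕ (suc (List.length L))
    split : ∀ t {k} → (if t then fromℕ k else 0ℚ) ≡ fromℕ (if t then k else 0)
    split true  = refl
    split false = refl

module _ {n} (G : Graph n) {M : ESet (raw G)} {L : List (ESet (raw G))}
         (perfect : All.All (T ∘ isPM (raw G)) (M List.∷ L)) where

  private
    R : RawGraph n
    R = raw G
    x : EVec R
    x = avg R (M List.∷ L)
    N : ℚ
    N = fromℕ (suc (List.length L))
    0<N : ℚ.Positive N
    0<N = ℚ.positive (fromℕ-pos (List.length L))

  avg-δv : ∀ v → setSum R x (δv R v) ≡ 1ℚ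
  avg-δv v = *-cancelˡ-≡-pos (fromℕ-pos (List.length L)) (begin
    N *ℚ setSum R x (δv R v)
      ≡⟨ fromℕ*setSum-avg R M L (δv R v) ⟩
    fromℕ (ℕ.sum (List.map (λ M′ → common-edges R M′ (δv R v)) (M List.∷ L)))
      ≡⟨ cong fromℕ (sum-map-ones _ (M List.∷ L) (All.map (λ pm → common-edges-δv G pm v) perfect)) ⟩
    N
      ≡⟨ ℚ.*-identityʳ N ⟨
    N *ℚ 1ℚ ∎)
    where open ≡-Reasoning

  -- N·x(δ(S)) is N plus twice an integer, so exceeding N it exceeds it by at least 2.
  avg-odd-cut-gap : ∀ S → ¬ 2 ∣ ∣ S ∣ → 1ℚ < setSum R x (δ R S) → N *ℚ 1ℚ + fromℕ 2 ≤ N *ℚ setSum R x (δ R S)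
  avg-odd-cut-gap S ¬2∣S 1<xS with sum-of-odds (List.map (λ M′ → common-edges R M′ (δ R S)) (M List.∷ L))
                                         (All.map⁺ (All.map (λ pm → common-edges-δ-odd G pm S ¬2∣S) perfect))
  ... | J , sum≡ = begin
    N *ℚ 1ℚ + fromℕ 2                           ≡⟨ cong (_+ fromℕ 2) (ℚ.*-identityʳ N) ⟩
    N + fromℕ 2                                 ≡⟨ fromℕ-homo-+ (suc (List.length L)) 2 ⟨
    fromℕ (suc (List.length L) ℕ.+ 2)           ≤⟨ fromℕ-mono-≤ (n<n+2j⇒n+2≤n+2j _ J (fromℕ-cancel-< {suc (List.length L)} N<N+2J)) ⟩
    fromℕ (suc (List.length L) ℕ.+ 2 * J)       ≡⟨ N*x≡N+2J ⟨
    N *ℚ setSum R x (δ R S)                     ∎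
    where
    open ℚ.≤-Reasoning
    N*x≡N+2J : N *ℚ setSum R x (δ R S) ≡ fromℕ (suc (List.length L) ℕ.+ 2 * J)
    N*x≡N+2J = trans (fromℕ*setSum-avg R M L (δ R S))
      (cong fromℕ (trans sum≡ (cong (ℕ._+ 2 * J) (List.length-map _ (M List.∷ L)))))
    N<N+2J : fromℕ (suc (List.length L)) < fromℕ (suc (List.length L) ℕ.+ 2 * J)
    N<N+2J = subst₂ _<_ (ℚ.*-identityʳ N) N*x≡N+2J (ℚ.*-monoʳ-<-pos N {{0<N}} 1<xS)

  avg-support-gap : ∀ e → 0ℚ < x e → N *ℚ 0ℚ + fromℕ 1 ≤ N *ℚ x e
  avg-support-gap e 0<xe = begin
    N *ℚ 0ℚ + fromℕ 1       ≡⟨ trans (cong (_+ fromℕ 1) (ℚ.*-zeroʳ N)) (ℚ.+-identityˡ (fromℕ 1)) ⟩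
    fromℕ 1                 ≤⟨ fromℕ-mono-≤ (fromℕ-cancel-< {0} {c} 0<c) ⟩
    fromℕ c                 ≡⟨ N*x≡c ⟨
    N *ℚ x e                ∎
    where
    open ℚ.≤-Reasoning
    c = multiplicity R (M List.∷ L) e
    N*x≡c : N *ℚ x e ≡ fromℕ c
    N*x≡c = fromℕ-*-/ c (List.length L)
    0<c : fromℕ 0 < fromℕ c
    0<c = subst₂ _<_ (ℚ.*-zeroʳ N) N*x≡c (ℚ.*-monoʳ-<-pos N {{0<N}} 0<xe)

  avg-nonNeg : ∀ e → 0ℚ ≤ x e
  avg-nonNeg e = ℚ.nonNegative⁻¹ (x e) {{ℚ.normalize-nonNeg (multiplicity R (M List.∷ L) e) (suc (List.length L))}}

-- Perturbing the average along an even walk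

module _ {n} (G : Graph n) {M : ESet (raw G)} {L : List (ESet (raw G))}
         (perfect : All.All (T ∘ isPM (raw G)) (M List.∷ L)) (few : suc (List.length L) ℕ.≤ K n)
         {W : List (Fin (m (raw G)))} (ew : EvenWalk (raw G) W)
         {ε : ℚ} (0<ε : 0ℚ < ε) (ε-small : ε *ℚ fromℕ (2 * n * K n) < 1ℚ) where

  private
    R : RawGraph n
    R = raw G
    x y : EVec R
    x = avg R (M List.∷ L)
    y e = x e + ε *ℚ χ R W e
    N : ℚ
    N = fromℕ (suc (List.length L))

    setSum-y : ∀ F → setSum R y F ≡ setSum R x F + ε *ℚ setSum R (χ R W) F
    setSum-y F = trans (setSum-+ R x (λ e → ε *ℚ χ R W e) F) (cong (_+_ (setSum R x F)) (setSum-* R ε (χ R W) F))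

    ε[2n·K]≤1 : ε *ℚ (fromℕ (2 * n) *ℚ fromℕ (K n)) ≤ 1ℚ
    ε[2n·K]≤1 = ℚ.<⇒≤ (subst (λ z → ε *ℚ z < 1ℚ) (fromℕ-homo-* (2 * n) (K n)) ε-small)

    perturbation-≥′ : ∀ k r s t → 0ℚ ≤ k → ℚ.∣ t ∣ ≤ k *ℚ fromℕ (2 * n) → N *ℚ r + k ≤ N *ℚ s → r ≤ s + ε *ℚ t
    perturbation-≥′ k r s t 0≤k = perturbation-≥ {N} {fromℕ (K n)} {k} {fromℕ (2 * n)} {ε} {r} {s} {t}
      (fromℕ-pos (List.length L)) (fromℕ-mono-≤ few) 0≤k (ℚ.<⇒≤ 0<ε) ε[2n·K]≤1

  perturbed-δv : ∀ v → setSum R y (δv R v) ≡ 1ℚ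
  perturbed-δv v = begin
    setSum R y (δv R v)                                      ≡⟨ setSum-y (δv R v) ⟩
    setSum R x (δv R v) + ε *ℚ setSum R (χ R W) (δv R v)
      ≡⟨ cong₂ (λ a b → a + ε *ℚ b) (avg-δv G perfect v) (evenWalk-δv G ew v) ⟩
    1ℚ + ε *ℚ 0ℚ                                             ≡⟨ cong (_+_ 1ℚ) (ℚ.*-zeroʳ ε) ⟩
    1ℚ                                                       ∎
    where open ≡-Reasoning

  perturbed-δ-odd : ∀ S → ¬ 2 ∣ ∣ S ∣ → 1ℚ < setSum R x (δ R S) → 1ℚ ≤ setSum R y (δ R S)
  perturbed-δ-odd S ¬2∣S 1<xS = subst (1ℚ ≤_) (sym (setSum-y (δ R S)))
    (perturbation-≥′ (fromℕ 2) 1ℚ (setSum R x (δ R S)) χ[δS] (fromℕ-nonNeg 2) ∣χ[δS]∣≤2·2n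
      (avg-odd-cut-gap G perfect S ¬2∣S 1<xS))
    where
    χ[δS] = setSum R (χ R W) (δ R S)
    ∣χ[δS]∣≤2·2n : ℚ.∣ χ[δS] ∣ ≤ fromℕ 2 *ℚ fromℕ (2 * n)
    ∣χ[δS]∣≤2·2n = subst (ℚ.∣ χ[δS] ∣ ≤_) (fromℕ-homo-* 2 (2 * n)) (evenWalk-∣setSum-χ∣≤ R ew (δ R S))

  perturbed-nonNeg : (∀ e → e ∈ W → 0ℚ < x e) → ∀ e → 0ℚ ≤ y e
  perturbed-nonNeg x>0 e = by-membership (Any.any? (e Fin.≟_) W)
    where
    ∣χ∣≤1·2n : ℚ.∣ χ R W e ∣ ≤ 1ℚ *ℚ fromℕ (2 * n)
    ∣χ∣≤1·2n = subst (ℚ.∣ χ R W e ∣ ≤_) (sym (ℚ.*-identityˡ (fromℕ (2 * n)))) (evenWalk-∣χ∣≤ R ew e)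
    y≡x : ¬ e ∈ W → y e ≡ x e
    y≡x e∉W = trans (cong (λ z → x e + ε *ℚ z) (χ-∉ R W e∉W))
                    (trans (cong (_+_ (x e)) (ℚ.*-zeroʳ ε)) (ℚ.+-identityʳ (x e)))
    by-membership : Dec (e ∈ W) → 0ℚ ≤ y e
    by-membership (yes e∈W) =
      perturbation-≥′ 1ℚ 0ℚ (x e) (χ R W e) (fromℕ-nonNeg 1) ∣χ∣≤1·2n (avg-support-gap G perfect e (x>0 e e∈W))
    by-membership (no e∉W) = subst (0ℚ ≤_) (sym (y≡x e∉W)) (avg-nonNeg G perfect e)

PerturbationBounds : ∀ {n} (G : RawGraph n) (x y : EVec G) → Set
PerturbationBounds {n} G x y =
  (∀ (v : Fin n) → setSum G y (δv G v) ≡ 1ℚ)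
  × (∀ (S : Subset n) → ¬ (2 ∣ ∣ S ∣) → 1ℚ < setSum G x (δ G S) → 1ℚ ≤ setSum G y (δ G S))
  × (∀ (e : Fin (m G)) → 0ℚ ≤ y e)

avg-perturbation : ∀ {n} (G : Graph n) (L : List (ESet (raw G))) → All.All (T ∘ isPM (raw G)) L →
                   0 ℕ.< List.length L → List.length L ℕ.≤ K n →
                   ∀ {W} → EvenWalk (raw G) W → (∀ e → e ∈ W → 0ℚ < avg (raw G) L e) →
                   ∀ {ε} → 0ℚ < ε → ε *ℚ fromℕ (2 * n * K n) < 1ℚ →
                   PerturbationBounds (raw G) (avg (raw G) L) (λ e → avg (raw G) L e + ε *ℚ χ (raw G) W e)
avg-perturbation G (M List.∷ L) perfect _ few ew x>0 0<ε ε-small =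
  perturbed-δv G perfect few ew 0<ε ε-small ,
  perturbed-δ-odd G perfect few ew 0<ε ε-small ,
  perturbed-nonNeg G perfect few ew 0<ε ε-small x>0

-- Counting perfect matchings

allSubsets-complete : ∀ k (p : Subset k) → p ∈ allSubsets k
allSubsets-complete zero    Vec.[] = here refl
allSubsets-complete (suc k) (Subset.inside Vec.∷ p) =
  ∈-++⁺ˡ (∈-map⁺ (Subset.inside Vec.∷_) (allSubsets-complete k p))
allSubsets-complete (suc k) (Subset.outside Vec.∷ p) =
  ∈-++⁺ʳ (List.map (Subset.inside Vec.∷_) (allSubsets k)) (∈-map⁺ (Subset.outside Vec.∷_) (allSubsets-complete k p))

allSubsets-unique : ∀ k → Unique (allSubsets k)
allSubsets-unique zero    = All.[] ∷ AllPairs.[]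
allSubsets-unique (suc k) = Unique.++⁺ (Unique.map⁺ Vec.∷-injectiveʳ (allSubsets-unique k))
                                       (Unique.map⁺ Vec.∷-injectiveʳ (allSubsets-unique k)) disjoint
  where
  disjoint : Disjoint (List.map (Subset.inside Vec.∷_) (allSubsets k))
                      (List.map (Subset.outside Vec.∷_) (allSubsets k))
  disjoint (p∈ins , p∈outs) with ∈-map⁻ _ p∈ins | ∈-map⁻ _ p∈outs
  ... | _ , _ , refl | _ , _ , ()

module _ {n} {G H : RawGraph n} (φ : Fin (m G) → Fin (m H)) (φ-injective : ∀ {e f} → φ e ≡ φ f → e ≡ f)
         (φ-incident : ∀ e v → incident H (φ e) v ≡ incident G e v) where

  image-hit? : ∀ M j → Dec (∃ λ e → e Subset.∈ M × φ e ≡ j)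
  image-hit? M j = Fin.any? (λ e → (e Subset.∈? M) ×-dec (φ e Fin.≟ j))

  image : ESet G → ESet H
  image M = Vec.tabulate (λ j → if ⌊ image-hit? M j ⌋ then Subset.inside else Subset.outside)

  ∈-image⁺ : ∀ {M e} → e Subset.∈ M → φ e Subset.∈ image M
  ∈-image⁺ {M} {e} e∈M =
    toWitness (subst T (sym (∈ᵇ-tabulate (λ j → ⌊ image-hit? M j ⌋) (φ e))) (fromWitness (e , e∈M , refl)))

  ∈-image⁻ : ∀ {M j} → j Subset.∈ image M → ∃ λ e → e Subset.∈ M × φ e ≡ j
  ∈-image⁻ {M} {j} j∈ = toWitness (subst T (∈ᵇ-tabulate (λ j → ⌊ image-hit? M j ⌋) j) (fromWitness j∈))

  image-injective : ∀ {M M′} → image M ≡ image M′ → M ≡ M′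
  image-injective eq = Subset.⊆-antisym (preimage eq) (preimage (sym eq))
    where
    preimage : ∀ {M M′} → image M ≡ image M′ → ∀ {e} → e Subset.∈ M → e Subset.∈ M′
    preimage {M′ = M′} eq {e} e∈M with ∈-image⁻ (subst (φ e Subset.∈_) eq (∈-image⁺ e∈M))
    ... | e′ , e′∈M′ , φe′≡φe = subst (Subset._∈ M′) (φ-injective φe′≡φe) e′∈M′

  image-isPM : ∀ {M} → T (isPM G M) → T (isPM H (image M))
  image-isPM {M} pm = degree≡1⇒isPM H degree≡1
    where
    degree≡1 : ∀ v → degIn H (image M) v ≡ 1
    degree≡1 v with countℕ≡1⇒unique _ (isPM⇒degree≡1 G pm v)
    ... | e₀ , at-e₀ , only-e₀ = unique⇒countℕ≡1 _ {φ e₀} at-φe₀ only-φe₀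
      where
      at-φe₀ : T (φ e₀ ∈ᵇ image M ∧ incident H (φ e₀) v)
      at-φe₀ with Bool.T-∧ {e₀ ∈ᵇ M} .Equivalence.to at-e₀
      ... | e₀∈M , e₀~v = Bool.T-∧ .Equivalence.from
        (fromWitness (∈-image⁺ (toWitness {a? = e₀ Subset.∈? M} e₀∈M)) , subst T (sym (φ-incident e₀ v)) e₀~v)
      only-φe₀ : ∀ j → T (j ∈ᵇ image M ∧ incident H j v) → j ≡ φ e₀
      only-φe₀ j at-j with Bool.T-∧ {j ∈ᵇ image M} .Equivalence.to at-j
      ... | j∈image , j~v with ∈-image⁻ {M} {j} (toWitness {a? = j Subset.∈? image M} j∈image)
      ...   | e , e∈M , refl = cong φ (only-e₀ e (Bool.T-∧ .Equivalence.from
              (fromWitness e∈M , subst T (φ-incident e v) j~v)))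

  length-perfectMatchings-≤ : List.length (perfectMatchings G) ℕ.≤ List.length (perfectMatchings H)
  length-perfectMatchings-≤ =
    subst (ℕ._≤ List.length (perfectMatchings H)) (List.length-map image (perfectMatchings G))
      (unique⇒length≤ (Unique.map⁺ image-injective (Unique.filter⁺ (T? ∘ isPM G) (allSubsets-unique (m G))))
                      image-perfect)
    where
    image-perfect : List.map image (perfectMatchings G) ⊆ perfectMatchings H
    image-perfect M′∈ with ∈-map⁻ image M′∈
    ... | M , M∈ , refl = ∈-filter⁺ (T? ∘ isPM H) (allSubsets-complete (m H) (image M))
                            (image-isPM (proj₂ (∈-filter⁻ (T? ∘ isPM G) {xs = allSubsets (m G)} M∈)))

sorted : ∀ {k} → Fin k × Fin k → Fin k × Fin k
sorted (a , b) = if ⌊ a Fin.<? b ⌋ then (a , b) else (b , a)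

sorted≡id⊎swap : ∀ {k} (p : Fin k × Fin k) → sorted p ≡ p ⊎ sorted p ≡ Product.swap p
sorted≡id⊎swap (a , b) with a Fin.<? b
... | yes _ = inj₁ refl
... | no _  = inj₂ refl

sorted-< : ∀ {k} {a b : Fin k} → a ≢ b → proj₁ (sorted (a , b)) Fin.< proj₂ (sorted (a , b))
sorted-< {a = a} {b} a≢b with a Fin.<? b
... | yes a<b = a<b
... | no a≮b  = Fin.≤∧≢⇒< (ℕ.≮⇒≥ a≮b) (a≢b ∘ sym)

sorted-injective : ∀ {k} {p q : Fin k × Fin k} → sorted p ≡ sorted q → p ≡ q ⊎ p ≡ Product.swap q
sorted-injective {p = p} {q} eq with sorted≡id⊎swap p | sorted≡id⊎swap q
... | inj₁ p′≡p | inj₁ q′≡q = inj₁ (trans (sym p′≡p) (trans eq q′≡q))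
... | inj₁ p′≡p | inj₂ q′≡q = inj₂ (trans (sym p′≡p) (trans eq q′≡q))
... | inj₂ p′≡p | inj₁ q′≡q = inj₂ (cong Product.swap (trans (sym p′≡p) (trans eq q′≡q)))
... | inj₂ p′≡p | inj₂ q′≡q = inj₁ (cong Product.swap (trans (sym p′≡p) (trans eq q′≡q)))

∈-completePairs : ∀ {k} {a b : Fin k} → a Fin.< b → (a , b) ∈ completePairs k
∈-completePairs {k} {a} {b} a<b =
  ∈-concatMap⁺ (λ i → List.map (i ,_) (List.filter (i Fin.<?_) (List.allFin k)))
    (lose (∈-allFin a) (∈-map⁺ (a ,_) (∈-filter⁺ (a Fin.<?_) (∈-allFin b) a<b)))

module _ {n} (G : Graph n) where

  private
    R : RawGraph n
    R = raw G
    touches : Fin n × Fin n → Fin n → Bool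
    touches (a , b) v = ⌊ a Fin.≟ v ⌋ ∨ ⌊ b Fin.≟ v ⌋

  sorted-ends∈ : ∀ e → sorted (ends R e) ∈ completePairs n
  sorted-ends∈ e = ∈-completePairs (sorted-< (loopless G e))

  toComplete : Fin (m R) → Fin (m (complete n))
  toComplete e = Any.index (sorted-ends∈ e)

  ends-toComplete : ∀ e → ends (complete n) (toComplete e) ≡ sorted (ends R e)
  ends-toComplete e = sym (Any.lookup-index (sorted-ends∈ e))

  toComplete-injective : ∀ {e f} → toComplete e ≡ toComplete f → e ≡ f
  toComplete-injective {e} {f} eq = simple G e f (sorted-injective
    (trans (sym (ends-toComplete e)) (trans (cong (ends (complete n)) eq) (ends-toComplete f))))

  toComplete-incident : ∀ e v → incident (complete n) (toComplete e) v ≡ incident R e v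
  toComplete-incident e v = trans (cong (λ p → touches p v) (ends-toComplete e)) (touches-sorted (ends R e))
    where
    touches-sorted : ∀ p → touches (sorted p) v ≡ touches p v
    touches-sorted p with sorted≡id⊎swap p
    ... | inj₁ p′≡p = cong (λ q → touches q v) p′≡p
    ... | inj₂ p′≡p = trans (cong (λ q → touches q v) p′≡p) (Bool.∨-comm ⌊ proj₂ p Fin.≟ v ⌋ ⌊ proj₁ p Fin.≟ v ⌋)

  length-perfectMatchings≤K : List.length (perfectMatchings R) ℕ.≤ K n
  length-perfectMatchings≤K =
    length-perfectMatchings-≤ {G = R} {H = complete n} toComplete toComplete-injective toComplete-incident

module _ {n} (G : Graph n) (w : EVec (raw G)) where

  private
    R : RawGraph n
    R = raw G

  PM-perfect : All.All (T ∘ isPM R) (PM R w)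
  PM-perfect = All.filter⁺ _ (All.all-filter (T? ∘ isPM R) (allSubsets (m R)))

  PM-nonempty : HasPerfectMatching R → 0 ℕ.< List.length (PM R w)
  PM-nonempty (M₀ , perfect₀) = ∈-length (∈-filter⁺ minimal? M*∈ M*-minimal)
    where
    open import Data.List.Extrema (DecTotalOrder.totalOrder ℚ.≤-decTotalOrder)
      using (argmin; argmin-sel; f[argmin]≤f[xs])
    minimal? = λ M → T? (allB (λ M′ → weight R w M ℚ.≤ᵇ weight R w M′) (perfectMatchings R))
    M₀∈ : M₀ ∈ perfectMatchings R
    M₀∈ = ∈-filter⁺ (T? ∘ isPM R) (allSubsets-complete (m R) M₀) perfect₀
    M* = argmin (weight R w) M₀ (perfectMatchings R)
    M*∈ : M* ∈ perfectMatchings R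
    M*∈ = Sum.[ (λ M*≡M₀ → subst (_∈ perfectMatchings R) (sym M*≡M₀) M₀∈) , id ]′
                (argmin-sel (weight R w) M₀ (perfectMatchings R))
    M*-minimal : T (allB (λ M′ → weight R w M* ℚ.≤ᵇ weight R w M′) (perfectMatchings R))
    M*-minimal = subst T (sym (allB≡all _ (perfectMatchings R)))
      (All.all⁻ _ (All.map (λ {M} → ℚ.≤⇒≤ᵇ {weight R w M*} {weight R w M}) (f[argmin]≤f[xs] M₀ (perfectMatchings R))))

  PM-length≤K : List.length (PM R w) ℕ.≤ K n
  PM-length≤K = ℕ.≤-trans (List.length-filter _ (perfectMatchings R)) (length-perfectMatchings≤K G)

lemma5p2 : ∀ (n : ℕ) (G : Graph n) → HasPerfectMatching (raw G) →
             (w : EVec (raw G)) →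
             let x = avg (raw G) (PM (raw G) w) in
             (W : List (Fin (m (raw G)))) → EvenWalk (raw G) W →
             (∀ e → e ∈ W → 0ℚ < x e) →
             inner (raw G) w (χ (raw G) W) < 0ℚ →
             (ε : ℚ) → 0ℚ < ε → ε *ℚ ((+ (2 * n * K n)) / 1) < 1ℚ →
             let y = λ e → x e + ε *ℚ χ (raw G) W e in
             (∀ (v : Fin n) → setSum (raw G) y (δv (raw G) v) ≡ 1ℚ)
             × (∀ (S : Subset n) → ¬ (2 ∣ ∣ S ∣) →
                  1ℚ < setSum (raw G) x (δ (raw G) S) → 1ℚ ≤ setSum (raw G) y (δ (raw G) S))
             × (∀ (e : Fin (m (raw G))) → 0ℚ ≤ y e)
lemma5p2 n G hasPM w W ew x>0 _ ε 0<ε ε-small =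
  avg-perturbation G (PM (raw G) w) (PM-perfect G w) (PM-nonempty G w hasPM) (PM-length≤K G w) ew x>0 0<ε ε-small
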